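{- Let $\mathfrak a_{n,m,d}$ be the number of $\sigma\in\mathcal{I}_n(000,010)$ with $\max(\sigma)=m$ and exactly $d$ distinct values. Let $\mathfrak b_{n,k}$ be the number of words $\omega$ of length $n$ over $\{0,\dots,k-1\}$ avoiding both $000$ and $010$, in which every letter of $\{0,\dots,k-1\}$ appears at least once, and with $\omega_1=k-1$. Then for all integers $2\leqslant d\leqslant m+1\leqslant n$, $$\mathfrak a_{n,m,d}=\sum_{i=0}^{d-1}\binom{m-i}{d-i-1}\sum_{p=m+1}^{n}\mathfrak b_{n-p+1,d-i}\sum_{j=0}^{m-1}\mathfrak a_{p-1,j,i}.$$
   Context: For $n\in\mathbb N$, an inversion sequence of size $n$ is a sequence $\sigma=(\sigma_1,\dots,\sigma_n)\in\mathbb N^n$ with $\sigma_i<i$ for all $i$. An integer sequence contains a pattern $\rho$ (a finite integer sequence such as $000$ or $010$) if it has a subsequence order-isomorphic to $\rho$, and avoids $\rho$ otherwise. $\mathcal{I}_n(P)$ denotes the set of inversion sequences of size $n$ avoiding every pattern in $P$. $\max(\sigma)$ is the largest entry of $\sigma$; for the empty sequence, $\max=-1$ and the number of distinct values is $0$. -}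

module Defs where

open import Data.Bool using (Bool; true; false; _∧_; not; if_then_else_)
open import Data.Nat using (ℕ; zero; suc; _+_; _∸_; _<ᵇ_; _≡ᵇ_; _⊔_)
open import Data.Integer using (ℤ; +_; -[1+_])
open import Data.List using (List; []; _∷_; [_]; _++_; map; concatMap; upTo; length; filterᵇ; deduplicateᵇ)
open import Data.Bool.ListAction using (any; all)
open import Data.Nat.ListAction using (sum)
open import Data.Bool using () renaming (_≟_ to _≟ᵇ_)

_==B_ : Bool → Bool → Bool
true  ==B b = b
false ==B b = not b

subseqs : ℕ → List ℕ → List (List ℕ)
subseqs zero    _        = [ [] ]
subseqs (suc k) []       = []
subseqs (suc k) (x ∷ xs) = map (x ∷_) (subseqs k xs) ++ subseqs (suc k) xs

sameOrder : ℕ → ℕ → ℕ → ℕ → Bool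
sameOrder x x' y y' = ((x <ᵇ x') ==B (y <ᵇ y')) ∧ ((x ≡ᵇ x') ==B (y ≡ᵇ y'))

orderIso : List ℕ → List ℕ → Bool
orderIso [] [] = true
orderIso [] (_ ∷ _) = false
orderIso (_ ∷ _) [] = false
orderIso (x ∷ xs) (y ∷ ys) = allPairs xs ys ∧ orderIso xs ys
  where
    allPairs : List ℕ → List ℕ → Bool
    allPairs [] [] = true
    allPairs (x' ∷ xs') (y' ∷ ys') = sameOrder x x' y y' ∧ allPairs xs' ys'
    allPairs _ _ = false

contains : List ℕ → List ℕ → Bool
contains σ ρ = any (orderIso ρ) (subseqs (length ρ) σ)

avoids : List ℕ → List ℕ → Bool
avoids σ ρ = not (contains σ ρ)

pat000 : List ℕ
pat000 = 0 ∷ 0 ∷ 0 ∷ []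

pat010 : List ℕ
pat010 = 0 ∷ 1 ∷ 0 ∷ []

avoids000-010 : List ℕ → Bool
avoids000-010 σ = avoids σ pat000 ∧ avoids σ pat010

-- all inversion sequences of size n: σ_i < i (1-indexed)
invSeqs : ℕ → List (List ℕ)
invSeqs zero    = [ [] ]
invSeqs (suc n) = concatMap (λ s → map (λ v → s ++ [ v ]) (upTo (suc n))) (invSeqs n)

words : ℕ → ℕ → List (List ℕ)
words zero    k = [ [] ]
words (suc n) k = concatMap (λ w → map (λ v → v ∷ w) (upTo k)) (words n k)

-- maximum entry, with max of the empty sequence = -1
maxSeq : List ℕ → ℤ
maxSeq [] = -[1+ 0 ]
maxSeq (x ∷ xs) = + (x ⊔ go xs)
  where
    go : List ℕ → ℕ
    go [] = 0
    go (y ∷ ys) = y ⊔ go ys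

eqℤ : ℤ → ℤ → Bool
eqℤ (+ a) (+ b) = a ≡ᵇ b
eqℤ -[1+ a ] -[1+ b ] = a ≡ᵇ b
eqℤ _ _ = false

distinct : List ℕ → ℕ
distinct σ = length (deduplicateᵇ _≡ᵇ_ σ)

elemᵇ : ℕ → List ℕ → Bool
elemᵇ v w = any (v ≡ᵇ_) w

firstIs : ℕ → List ℕ → Bool
firstIs c [] = false
firstIs c (x ∷ _) = x ≡ᵇ c

𝔞 : ℕ → ℕ → ℕ → ℕ
𝔞 n m d = length (filterᵇ (λ σ → avoids000-010 σ ∧ eqℤ (maxSeq σ) (+ m) ∧ (distinct σ ≡ᵇ d)) (invSeqs n))

𝔟 : ℕ → ℕ → ℕ
𝔟 n k = length (filterᵇ (λ ω → avoids000-010 ω ∧ all (λ v → elemᵇ v ω) (upTo k) ∧ firstIs (k ∸ 1) ω) (words n k))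

-- Σ_{i=a}^{b} f i  (empty if b < a)
sumFromTo : ℕ → ℕ → (ℕ → ℕ) → ℕ
sumFromTo a b f = sum (map (λ t → f (a + t)) (upTo (suc b ∸ a)))

-- Cut σ at the first occurrence of its maximum m: σ = τ ++ m ∷ ω, where τ is an inversion sequence
-- of length p − 1 ≥ m with entries below m.  σ avoids 000 and 010 exactly when τ and m ∷ ω do and
-- no letter of τ occurs in ω, since a shared letter t < m would give the pattern t m t; and the
-- bounds on the entries of ω are implied by ω_i ≤ m.  So if τ has i distinct letters and maximum
-- j < m, the tail m ∷ ω has d − i letters, d − i − 1 of which are chosen among the m − i letters
-- below m missing from τ; relabelling the letters of m ∷ ω increasingly onto 0, …, d − i − 1 turns
-- it into a word counted by 𝔟 (n − p + 1) (d − i), while τ is counted by 𝔞 (p − 1) j i.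

module Submission where

open import Algebra.Bundles using (CommutativeMonoid)
open import Data.Bool using (Bool; true; false; _∧_; _∨_; not; if_then_else_)
open import Data.Bool.ListAction using (any; all)
open import Data.Bool.Properties
  using (∧-assoc; ∨-assoc; ∧-zeroʳ; ∨-zeroʳ; ∧-identityʳ; ∨-identityʳ; T-≡; ∨-commutativeMonoid; ∨-∧-booleanAlgebra)
open import Data.Empty using (⊥-elim)
open import Data.Integer using (ℤ; -[1+_]) renaming (+_ to pos)
open import Data.List
  using (List; []; _∷_; [_]; _++_; map; concatMap; upTo; downFrom; length; filter; filterᵇ; deduplicateᵇ; applyUpTo)
open import Data.List.Properties using (upTo-∷ʳ; ++-assoc; ++-identityʳ; length-upTo; map-upTo)
open import Data.List.Relation.Unary.All using (All; []; _∷_)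
import Data.List.Relation.Unary.All as All
import Data.List.Relation.Unary.All.Properties as All
open import Data.List.Relation.Unary.AllPairs using (AllPairs; []; _∷_)
import Data.List.Relation.Unary.AllPairs.Properties as AllPairs
open import Data.Nat using (ℕ; zero; suc; _+_; _*_; _∸_; _<ᵇ_; _≡ᵇ_; _≤_; _<_; _>_; z≤n; s≤s; _⊔_)
open import Data.Nat.Combinatorics using (_C_; nCk+nC[k+1]≡[n+1]C[k+1])
open import Data.Nat.ListAction using (sum)
open import Data.Nat.Properties
open import Data.Product using (_,_; proj₂)
open import Data.Sum using (inj₁; inj₂)
open import Function.Base using (id; _∘_; case_of_)
open import Function.Bundles using (Equivalence)
open import Relation.Binary using (tri<; tri≈; tri>; _Preserves_⟶_)
open import Relation.Binary.PropositionalEquality hiding ([_])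
open import Relation.Nullary using (Dec; yes; no; ¬?)
open import Relation.Nullary.Decidable.Core using (T?)

open import Algebra.Lattice.Properties.BooleanAlgebra ∨-∧-booleanAlgebra using (deMorgan₂)
open import Algebra.Properties.CommutativeSemigroup +-commutativeSemigroup
  using () renaming (interchange to +-interchange)
open import Algebra.Properties.CommutativeSemigroup (CommutativeMonoid.commutativeSemigroup ∨-commutativeMonoid)
  using () renaming (interchange to ∨-interchange)

open import Defs

-- Indicators and finite sums

𝟙 : Bool → ℕ
𝟙 true  = 1
𝟙 false = 0

𝟙-∧ : ∀ a b → 𝟙 (a ∧ b) ≡ 𝟙 a * 𝟙 b
𝟙-∧ true  b = sym (+-identityʳ (𝟙 b))
𝟙-∧ false b = refl

𝟙-∧ʳ : ∀ a b c → 𝟙 (a ∧ b ∧ c) ≡ 𝟙 c * 𝟙 (a ∧ b)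
𝟙-∧ʳ a b true  rewrite ∧-identityʳ b = sym (+-identityʳ _)
𝟙-∧ʳ a b false rewrite ∧-zeroʳ b | ∧-zeroʳ a = refl

𝟙-∧-middle : ∀ a b c → 𝟙 (a ∧ b ∧ c) ≡ 𝟙 (a ∧ c) * 𝟙 b
𝟙-∧-middle false b     c = refl
𝟙-∧-middle true  true  c = sym (*-identityʳ (𝟙 c))
𝟙-∧-middle true  false c = sym (*-zeroʳ (𝟙 c))

𝟙-not+𝟙 : ∀ b → 𝟙 (not b) + 𝟙 b ≡ 1
𝟙-not+𝟙 true  = refl
𝟙-not+𝟙 false = refl

𝟙-not-∨ : ∀ a b → 𝟙 (not (a ∨ b)) ≡ 𝟙 (not a) * 𝟙 (not b)
𝟙-not-∨ true  b = refl
𝟙-not-∨ false b = sym (+-identityʳ _)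

𝟙-split : ∀ c g → g ≡ 𝟙 c * g + 𝟙 (not c) * g
𝟙-split true  g = trans (sym (+-identityʳ g)) (cong (_+ 0) (sym (+-identityʳ g)))
𝟙-split false g = sym (+-identityʳ g)

∨-falseʳ : ∀ {a b} → (a ∨ b) ≡ false → b ≡ false
∨-falseʳ {false} b≡false = b≡false

∑ : {A : Set} → List A → (A → ℕ) → ℕ
∑ []       f = 0
∑ (x ∷ xs) f = f x + ∑ xs f

infix 5 ∑
syntax ∑ L (λ x → e) = ∑[ x ∈ L ] e

module _ {A : Set} where

  length-filterᵇ≡∑ : (P : A → Bool) (L : List A) → length (filterᵇ P L) ≡ ∑[ x ∈ L ] 𝟙 (P x)
  length-filterᵇ≡∑ P []      = refl
  length-filterᵇ≡∑ P (x ∷ L) with P x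
  ... | true  = cong suc (length-filterᵇ≡∑ P L)
  ... | false = length-filterᵇ≡∑ P L

  sum-map≡∑ : (f : A → ℕ) (L : List A) → sum (map f L) ≡ ∑ L f
  sum-map≡∑ f []      = refl
  sum-map≡∑ f (x ∷ L) = cong (f x +_) (sum-map≡∑ f L)

  ∑-cong : (L : List A) {f g : A → ℕ} → (∀ x → f x ≡ g x) → ∑ L f ≡ ∑ L g
  ∑-cong []      f≗g = refl
  ∑-cong (x ∷ L) f≗g = cong₂ _+_ (f≗g x) (∑-cong L f≗g)

  ∑-++ : (L M : List A) (f : A → ℕ) → ∑ (L ++ M) f ≡ ∑ L f + ∑ M f
  ∑-++ []      M f = refl
  ∑-++ (x ∷ L) M f = trans (cong (f x +_) (∑-++ L M f)) (sym (+-assoc (f x) _ _))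

  ∑-zero : (L : List A) → ∑[ _ ∈ L ] 0 ≡ 0
  ∑-zero []      = refl
  ∑-zero (x ∷ L) = ∑-zero L

  ∑-≡0 : (L : List A) {f : A → ℕ} → (∀ x → f x ≡ 0) → ∑ L f ≡ 0
  ∑-≡0 L f≗0 = trans (∑-cong L f≗0) (∑-zero L)

  ∑-+ : (L : List A) (f g : A → ℕ) → ∑[ x ∈ L ] (f x + g x) ≡ ∑ L f + ∑ L g
  ∑-+ []      f g = refl
  ∑-+ (x ∷ L) f g = trans (cong (f x + g x +_) (∑-+ L f g)) (+-interchange (f x) (g x) _ _)

  ∑-*ˡ : (L : List A) (c : ℕ) (f : A → ℕ) → ∑[ x ∈ L ] c * f x ≡ c * ∑ L f
  ∑-*ˡ []      c f = sym (*-zeroʳ c)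
  ∑-*ˡ (x ∷ L) c f = trans (cong (c * f x +_) (∑-*ˡ L c f)) (sym (*-distribˡ-+ c (f x) (∑ L f)))

  length≡∑1 : (L : List A) → length L ≡ ∑[ _ ∈ L ] 1
  length≡∑1 []      = refl
  length≡∑1 (x ∷ L) = cong suc (length≡∑1 L)

module _ {A B : Set} where

  ∑-map : (L : List A) (g : A → B) (f : B → ℕ) → ∑ (map g L) f ≡ ∑[ x ∈ L ] f (g x)
  ∑-map []      g f = refl
  ∑-map (x ∷ L) g f = cong (f (g x) +_) (∑-map L g f)

  ∑-concatMap : (L : List A) (h : A → List B) (f : B → ℕ) → ∑ (concatMap h L) f ≡ ∑[ x ∈ L ] ∑ (h x) f
  ∑-concatMap []      h f = refl
  ∑-concatMap (x ∷ L) h f = trans (∑-++ (h x) (concatMap h L) f) (cong (∑ (h x) f +_) (∑-concatMap L h f))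

  ∑-comm : (L : List A) (M : List B) (f : A → B → ℕ) → ∑[ x ∈ L ] ∑[ y ∈ M ] f x y ≡ ∑[ y ∈ M ] ∑[ x ∈ L ] f x y
  ∑-comm []      M f = sym (∑-zero M)
  ∑-comm (x ∷ L) M f = trans (cong (∑ M (f x) +_) (∑-comm L M f)) (sym (∑-+ M (f x) (λ y → ∑[ x′ ∈ L ] f x′ y)))

≡ᵇ-refl : ∀ n → (n ≡ᵇ n) ≡ true
≡ᵇ-refl n = Equivalence.to T-≡ (≡⇒≡ᵇ n n refl)

≡ᵇ-true⇒≡ : ∀ m n → (m ≡ᵇ n) ≡ true → m ≡ n
≡ᵇ-true⇒≡ m n e = ≡ᵇ⇒≡ m n (Equivalence.from T-≡ e)

≢⇒≡ᵇ-false : ∀ m n → m ≢ n → (m ≡ᵇ n) ≡ false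
≢⇒≡ᵇ-false m n m≢n with m ≡ᵇ n in e
... | true  = ⊥-elim (m≢n (≡ᵇ-true⇒≡ m n e))
... | false = refl

≡ᵇ-sym : ∀ m n → (m ≡ᵇ n) ≡ (n ≡ᵇ m)
≡ᵇ-sym zero    zero    = refl
≡ᵇ-sym zero    (suc n) = refl
≡ᵇ-sym (suc m) zero    = refl
≡ᵇ-sym (suc m) (suc n) = ≡ᵇ-sym m n

<⇒<ᵇ-true : ∀ {m n} → m < n → (m <ᵇ n) ≡ true
<⇒<ᵇ-true m<n = Equivalence.to T-≡ (<⇒<ᵇ m<n)

<ᵇ-true⇒< : ∀ m n → (m <ᵇ n) ≡ true → m < n
<ᵇ-true⇒< m n e = <ᵇ⇒< m n (Equivalence.from T-≡ e)

≤⇒>ᵇ-false : ∀ {m n} → n ≤ m → (m <ᵇ n) ≡ false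
≤⇒>ᵇ-false {m} {n} n≤m with m <ᵇ n in e
... | true  = ⊥-elim (<⇒≱ (<ᵇ-true⇒< m n e) n≤m)
... | false = refl

+-≡ᵇ-∸ : ∀ a D d → 1 ≤ D → (a + D ≡ᵇ d) ≡ (D ≡ᵇ d ∸ a)
+-≡ᵇ-∸ a D d 1≤D with ≤-total a d
... | inj₁ a≤d = trans (cong (a + D ≡ᵇ_) (sym (m+[n∸m]≡n a≤d))) (+-cancelˡ-≡ᵇ a)
  where
  +-cancelˡ-≡ᵇ : ∀ a {x y} → (a + x ≡ᵇ a + y) ≡ (x ≡ᵇ y)
  +-cancelˡ-≡ᵇ zero    = refl
  +-cancelˡ-≡ᵇ (suc a) = +-cancelˡ-≡ᵇ a
... | inj₂ d≤a rewrite m≤n⇒m∸n≡0 d≤a =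
  trans (≢⇒≡ᵇ-false (a + D) d (>⇒≢ (≤-<-trans d≤a (m<m+n a 1≤D)))) (sym (≢⇒≡ᵇ-false D 0 (>⇒≢ 1≤D)))

𝟙-≡ᵇ-subst : ∀ (f : ℕ → ℕ) a b → 𝟙 (a ≡ᵇ b) * f a ≡ 𝟙 (a ≡ᵇ b) * f b
𝟙-≡ᵇ-subst f a b with a ≡ᵇ b in a≡b
... | true rewrite ≡ᵇ-true⇒≡ a b a≡b = refl
... | false = refl

∸-suc : ∀ {y k} → y < k → k ∸ y ≡ suc (k ∸ suc y)
∸-suc {y} {k} = +-∸-assoc 1 {k} {suc y}

<∸⇒+< : ∀ {m n t} → t < n ∸ m → m + t < n
<∸⇒+< {zero}          t<n   = t<n
<∸⇒+< {suc m} {suc n} t<n∸m = s≤s (<∸⇒+< {m} {n} t<n∸m)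

∑-upTo-suc : (n : ℕ) (f : ℕ → ℕ) → ∑ (upTo (suc n)) f ≡ ∑ (upTo n) f + f n
∑-upTo-suc n f = begin
  ∑ (upTo (suc n)) f       ≡⟨ cong (λ L → ∑ L f) (upTo-∷ʳ n) ⟨
  ∑ (upTo n ++ [ n ]) f    ≡⟨ ∑-++ (upTo n) [ n ] f ⟩
  ∑ (upTo n) f + (f n + 0) ≡⟨ cong (∑ (upTo n) f +_) (+-identityʳ (f n)) ⟩
  ∑ (upTo n) f + f n       ∎
  where open ≡-Reasoning

∑-upTo-cong : (n : ℕ) {f g : ℕ → ℕ} → (∀ v → v < n → f v ≡ g v) → ∑ (upTo n) f ≡ ∑ (upTo n) g
∑-upTo-cong zero    f≗g = refl
∑-upTo-cong (suc n) {f} {g} f≗g = begin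
  ∑ (upTo (suc n)) f ≡⟨ ∑-upTo-suc n f ⟩
  ∑ (upTo n) f + f n ≡⟨ cong₂ _+_ (∑-upTo-cong n (λ v v<n → f≗g v (m<n⇒m<1+n v<n))) (f≗g n ≤-refl) ⟩
  ∑ (upTo n) g + g n ≡⟨ ∑-upTo-suc n g ⟨
  ∑ (upTo (suc n)) g ∎
  where open ≡-Reasoning

∑-upTo-zero : (n : ℕ) {f : ℕ → ℕ} → (∀ v → v < n → f v ≡ 0) → ∑ (upTo n) f ≡ 0
∑-upTo-zero n f≗0 = trans (∑-upTo-cong n f≗0) (∑-zero (upTo n))

∑-upTo-δ : (n a : ℕ) (f : ℕ → ℕ) → a < n → ∑[ v ∈ upTo n ] 𝟙 (v ≡ᵇ a) * f v ≡ f a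
∑-upTo-δ (suc n) a f a<1+n = begin
  ∑[ v ∈ upTo (suc n) ] 𝟙 (v ≡ᵇ a) * f v                 ≡⟨ ∑-upTo-suc n _ ⟩
  (∑[ v ∈ upTo n ] 𝟙 (v ≡ᵇ a) * f v) + 𝟙 (n ≡ᵇ a) * f n ≡⟨ last (a ≟ n) ⟩
  f a                                                    ∎
  where
  open ≡-Reasoning
  last : Dec (a ≡ n) → (∑[ v ∈ upTo n ] 𝟙 (v ≡ᵇ a) * f v) + 𝟙 (n ≡ᵇ a) * f n ≡ f a
  last (yes refl) rewrite ≡ᵇ-refl a = trans
    (cong (_+ (f a + 0)) (∑-upTo-zero a (λ v v<a → cong (λ b → 𝟙 b * f v) (≢⇒≡ᵇ-false v a (<⇒≢ v<a)))))
    (+-identityʳ (f a))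
  last (no a≢n) rewrite ≢⇒≡ᵇ-false n a (≢-sym a≢n) =
    trans (+-identityʳ _) (∑-upTo-δ n a f (≤∧≢⇒< (≤-pred a<1+n) a≢n))

∑-upTo-+ : (M k : ℕ) (F : ℕ → ℕ) → ∑ (upTo (M + k)) F ≡ ∑ (upTo M) F + (∑[ t ∈ upTo k ] F (M + t))
∑-upTo-+ M zero    F rewrite +-identityʳ M = sym (+-identityʳ _)
∑-upTo-+ M (suc k) F rewrite +-suc M k | ∑-upTo-suc (M + k) F | ∑-upTo-suc k (λ t → F (M + t)) | ∑-upTo-+ M k F =
  +-assoc (∑ (upTo M) F) _ (F (M + k))

∑-upTo-suc′ : (n : ℕ) (f : ℕ → ℕ) → ∑ (upTo (suc n)) f ≡ f 0 + (∑[ t ∈ upTo n ] f (suc t))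
∑-upTo-suc′ n f = cong (f 0 +_) (trans (cong (λ L → ∑ L f) (sym (map-upTo suc n))) (∑-map (upTo n) suc f))

∑-upTo-restrict : (N M : ℕ) (F : ℕ → ℕ) → M ≤ N → ∑[ v ∈ upTo N ] 𝟙 (v <ᵇ M) * F v ≡ ∑ (upTo M) F
∑-upTo-restrict N M F M≤N = begin
  ∑[ v ∈ upTo N ] 𝟙 (v <ᵇ M) * F v
    ≡⟨ cong (λ K → ∑[ v ∈ upTo K ] 𝟙 (v <ᵇ M) * F v) (m+[n∸m]≡n M≤N) ⟨
  ∑[ v ∈ upTo (M + (N ∸ M)) ] 𝟙 (v <ᵇ M) * F v
    ≡⟨ ∑-upTo-+ M (N ∸ M) _ ⟩
  (∑[ v ∈ upTo M ] 𝟙 (v <ᵇ M) * F v) + (∑[ t ∈ upTo (N ∸ M) ] 𝟙 (M + t <ᵇ M) * F (M + t))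
    ≡⟨ cong₂ _+_ (∑-upTo-cong M (λ v v<M → trans (cong (λ b → 𝟙 b * F v) (<⇒<ᵇ-true v<M)) (+-identityʳ (F v))))
                 (∑-upTo-zero (N ∸ M) (λ t _ → cong (λ b → 𝟙 b * F (M + t)) (≤⇒>ᵇ-false (m≤m+n M t)))) ⟩
  ∑ (upTo M) F + 0
    ≡⟨ +-identityʳ _ ⟩
  ∑ (upTo M) F ∎
  where open ≡-Reasoning

∑-downFrom : (m : ℕ) (h : ℕ → ℕ) → ∑ (downFrom m) h ≡ ∑ (upTo m) h
∑-downFrom zero    h = refl
∑-downFrom (suc m) h = trans (cong (h m +_) (∑-downFrom m h)) (trans (+-comm (h m) _) (sym (∑-upTo-suc m h)))

∑-upTo-𝟙≡ᵇ : (M m : ℕ) → ∑[ j ∈ upTo m ] 𝟙 (M ≡ᵇ j) ≡ 𝟙 (M <ᵇ m)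
∑-upTo-𝟙≡ᵇ M m with M <? m
... | yes M<m rewrite <⇒<ᵇ-true M<m =
  trans (∑-cong (upTo m) (λ j → trans (cong 𝟙 (≡ᵇ-sym M j)) (sym (*-identityʳ _)))) (∑-upTo-δ m M (λ _ → 1) M<m)
... | no M≮m rewrite ≤⇒>ᵇ-false (≮⇒≥ M≮m) =
  ∑-upTo-zero m (λ j j<m → cong 𝟙 (≢⇒≡ᵇ-false M j (λ { refl → M≮m j<m })))

∑-by-value : ∀ {A : Set} (L : List A) (Q : A → Bool) (φ : A → ℕ) (h : ℕ → ℕ) N → (∀ x → N ≤ x → h x ≡ 0) →
  ∑[ τ ∈ L ] 𝟙 (Q τ) * h (φ τ) ≡ ∑[ i ∈ upTo N ] h i * (∑[ τ ∈ L ] 𝟙 (Q τ ∧ (φ τ ≡ᵇ i)))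
∑-by-value L Q φ h N h≥N≡0 = begin
  ∑[ τ ∈ L ] 𝟙 (Q τ) * h (φ τ)
    ≡⟨ ∑-cong L (λ τ → cong (𝟙 (Q τ) *_) (value (φ τ))) ⟩
  ∑[ τ ∈ L ] 𝟙 (Q τ) * (∑[ i ∈ upTo N ] 𝟙 (φ τ ≡ᵇ i) * h i)
    ≡⟨ ∑-cong L (λ τ → trans (sym (∑-*ˡ (upTo N) (𝟙 (Q τ)) _)) (∑-cong (upTo N) (λ i → rearrange (Q τ) (φ τ ≡ᵇ i) (h i)))) ⟩
  ∑[ τ ∈ L ] ∑[ i ∈ upTo N ] h i * 𝟙 (Q τ ∧ (φ τ ≡ᵇ i))
    ≡⟨ ∑-comm L (upTo N) _ ⟩
  ∑[ i ∈ upTo N ] ∑[ τ ∈ L ] h i * 𝟙 (Q τ ∧ (φ τ ≡ᵇ i))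
    ≡⟨ ∑-cong (upTo N) (λ i → ∑-*ˡ L (h i) _) ⟩
  ∑[ i ∈ upTo N ] h i * (∑[ τ ∈ L ] 𝟙 (Q τ ∧ (φ τ ≡ᵇ i))) ∎
  where
  open ≡-Reasoning
  value : ∀ x → h x ≡ ∑[ i ∈ upTo N ] 𝟙 (x ≡ᵇ i) * h i
  value x with x <? N
  ... | yes x<N = trans (sym (∑-upTo-δ N x h x<N)) (∑-cong (upTo N) (λ i → cong (λ b → 𝟙 b * h i) (≡ᵇ-sym i x)))
  ... | no  x≮N = trans (h≥N≡0 x (≮⇒≥ x≮N))
    (sym (∑-upTo-zero N (λ i i<N → cong (λ b → 𝟙 b * h i) (≢⇒≡ᵇ-false x i (>⇒≢ (<-≤-trans i<N (≮⇒≥ x≮N)))))))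
  rearrange : ∀ q e c → 𝟙 q * (𝟙 e * c) ≡ c * 𝟙 (q ∧ e)
  rearrange q e c rewrite 𝟙-∧ q e = trans (sym (*-assoc (𝟙 q) (𝟙 e) c)) (*-comm (𝟙 q * 𝟙 e) c)

sumFromTo-0 : ∀ k (f : ℕ → ℕ) → 1 ≤ k → sumFromTo 0 (k ∸ 1) f ≡ ∑ (upTo k) f
sumFromTo-0 (suc k) f _ = sum-map≡∑ f (upTo (suc k))

sumFromTo-suc : ∀ m n (g : ℕ → ℕ) → sumFromTo (m + 1) n g ≡ ∑[ t ∈ upTo (n ∸ m) ] g (suc (m + t))
sumFromTo-suc m n g rewrite +-comm m 1 = sum-map≡∑ _ (upTo (n ∸ m))

module _ {A : Set} where

  any-++ : (p : A → Bool) (L M : List A) → any p (L ++ M) ≡ (any p L ∨ any p M)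
  any-++ p []      M = refl
  any-++ p (x ∷ L) M = trans (cong (p x ∨_) (any-++ p L M)) (sym (∨-assoc (p x) (any p L) (any p M)))

  all-++ : (p : A → Bool) (L M : List A) → all p (L ++ M) ≡ (all p L ∧ all p M)
  all-++ p []      M = refl
  all-++ p (x ∷ L) M = trans (cong (p x ∧_) (all-++ p L M)) (sym (∧-assoc (p x) (all p L) (all p M)))

  any-cong : {p q : A → Bool} (L : List A) → (∀ x → p x ≡ q x) → any p L ≡ any q L
  any-cong []      p≗q = refl
  any-cong (x ∷ L) p≗q = cong₂ _∨_ (p≗q x) (any-cong L p≗q)

  all-cong : {p q : A → Bool} (L : List A) → (∀ x → p x ≡ q x) → all p L ≡ all q L
  all-cong []      p≗q = refl
  all-cong (x ∷ L) p≗q = cong₂ _∧_ (p≗q x) (all-cong L p≗q)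

  any-false : (L : List A) → any (λ _ → false) L ≡ false
  any-false []      = refl
  any-false (x ∷ L) = any-false L

  any-∨ : (p q : A → Bool) (L : List A) → (any p L ∨ any q L) ≡ any (λ x → p x ∨ q x) L
  any-∨ p q []      = refl
  any-∨ p q (x ∷ L) = trans (∨-interchange (p x) (any p L) (q x) (any q L)) (cong ((p x ∨ q x) ∨_) (any-∨ p q L))

  all-not : (p : A → Bool) (L : List A) → all (λ x → not (p x)) L ≡ not (any p L)
  all-not p []      = refl
  all-not p (x ∷ L) with p x
  ... | true  = refl
  ... | false = all-not p L

module _ {A B : Set} where

  any-map : (p : B → Bool) (f : A → B) (L : List A) → any p (map f L) ≡ any (λ x → p (f x)) L
  any-map p f []      = refl
  any-map p f (x ∷ L) = cong (p (f x) ∨_) (any-map p f L)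

  all-map : (p : B → Bool) (f : A → B) (L : List A) → all p (map f L) ≡ all (λ x → p (f x)) L
  all-map p f []      = refl
  all-map p f (x ∷ L) = cong (p (f x) ∧_) (all-map p f L)

  any-comm : (R : A → B → Bool) (L : List A) (M : List B) →
    any (λ x → any (R x) M) L ≡ any (λ y → any (λ x → R x y) L) M
  any-comm R []      M = sym (any-false M)
  any-comm R (x ∷ L) M = trans (cong (any (R x) M ∨_) (any-comm R L M)) (any-∨ (R x) _ M)

all-upTo-suc : (p : ℕ → Bool) (n : ℕ) → all p (upTo (suc n)) ≡ (all p (upTo n) ∧ p n)
all-upTo-suc p n = begin
  all p (upTo (suc n))          ≡⟨ cong (all p) (upTo-∷ʳ n) ⟨
  all p (upTo n ++ [ n ])       ≡⟨ all-++ p (upTo n) [ n ] ⟩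
  all p (upTo n) ∧ (p n ∧ true) ≡⟨ cong (all p (upTo n) ∧_) (∧-identityʳ (p n)) ⟩
  all p (upTo n) ∧ p n          ∎
  where open ≡-Reasoning

all-upTo-true : (p : ℕ → Bool) (n : ℕ) → all p (upTo n) ≡ true → ∀ v → v < n → p v ≡ true
all-upTo-true p (suc n) h v v<1+n rewrite all-upTo-suc p n with all p (upTo n) in e₁ | p n in e₂
all-upTo-true p (suc n) () v v<1+n | false | _
all-upTo-true p (suc n) () v v<1+n | true  | false
... | true | true with m<1+n⇒m<n∨m≡n v<1+n
... | inj₁ v<n  = all-upTo-true p n e₁ v v<n
... | inj₂ refl = e₂

all-upTo-cong : (p q : ℕ → Bool) (n : ℕ) → (∀ v → v < n → p v ≡ q v) → all p (upTo n) ≡ all q (upTo n)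
all-upTo-cong p q zero    p≗q = refl
all-upTo-cong p q (suc n) p≗q rewrite all-upTo-suc p n | all-upTo-suc q n =
  cong₂ _∧_ (all-upTo-cong p q n (λ v v<n → p≗q v (m<n⇒m<1+n v<n))) (p≗q n ≤-refl)

all-cong-bounded : (p q : ℕ → Bool) (K : ℕ) (ω : List ℕ) → all (_<ᵇ K) ω ≡ true →
  (∀ v → v < K → p v ≡ q v) → all p ω ≡ all q ω
all-cong-bounded p q K []      _ p≗q = refl
all-cong-bounded p q K (x ∷ ω) h p≗q with x <ᵇ K in x<K
all-cong-bounded p q K (x ∷ ω) () p≗q | false
... | true = cong₂ _∧_ (p≗q x (<ᵇ-true⇒< x K x<K)) (all-cong-bounded p q K ω h p≗q)

elemᵇ-++ : ∀ v A B → elemᵇ v (A ++ B) ≡ (elemᵇ v A ∨ elemᵇ v B)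
elemᵇ-++ v = any-++ (v ≡ᵇ_)

elemᵇ⇒any : (p : ℕ → Bool) (t : ℕ) (ω : List ℕ) → elemᵇ t ω ≡ true → p t ≡ true → any p ω ≡ true
elemᵇ⇒any p t (x ∷ ω) t∈ω pt with t ≡ᵇ x in t≡x
... | true rewrite sym (≡ᵇ-true⇒≡ t x t≡x) | pt = refl
... | false rewrite elemᵇ⇒any p t ω t∈ω pt = ∨-zeroʳ _

elemᵇ⇒all-false : (p : ℕ → Bool) (t : ℕ) (ω : List ℕ) → elemᵇ t ω ≡ true → p t ≡ false → all p ω ≡ false
elemᵇ⇒all-false p t (x ∷ ω) t∈ω pt with t ≡ᵇ x in t≡x
... | true rewrite sym (≡ᵇ-true⇒≡ t x t≡x) | pt = refl
... | false rewrite elemᵇ⇒all-false p t ω t∈ω pt = ∧-zeroʳ _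

all-<ᵇ⇒elemᵇ-false : ∀ m τ → all (_<ᵇ m) τ ≡ true → elemᵇ m τ ≡ false
all-<ᵇ⇒elemᵇ-false m []      _ = refl
all-<ᵇ⇒elemᵇ-false m (x ∷ τ) h with x <ᵇ m in x<m
all-<ᵇ⇒elemᵇ-false m (x ∷ τ) () | false
... | true rewrite ≢⇒≡ᵇ-false m x (>⇒≢ (<ᵇ-true⇒< x m x<m)) = all-<ᵇ⇒elemᵇ-false m τ h

all-<ᵇ-suc : ∀ m τ → elemᵇ m τ ≡ false → all (_<ᵇ suc m) τ ≡ all (_<ᵇ m) τ
all-<ᵇ-suc m []      _   = refl
all-<ᵇ-suc m (x ∷ τ) m∉τ with m ≡ᵇ x in m≡x
all-<ᵇ-suc m (x ∷ τ) () | true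
... | false = cong₂ _∧_ x<ᵇ1+m (all-<ᵇ-suc m τ m∉τ)
  where
  x<ᵇ1+m : (x <ᵇ suc m) ≡ (x <ᵇ m)
  x<ᵇ1+m with <-cmp x m
  ... | tri< x<m _ _ rewrite <⇒<ᵇ-true x<m = <⇒<ᵇ-true (m<n⇒m<1+n x<m)
  ... | tri≈ _ refl _ rewrite ≡ᵇ-refl x = case m≡x of λ ()
  ... | tri> _ _ x>m rewrite ≤⇒>ᵇ-false (<⇒≤ x>m) = ≤⇒>ᵇ-false x>m

All-<⇒elemᵇ-false : ∀ {a A} → All (a <_) A → elemᵇ a A ≡ false
All-<⇒elemᵇ-false []          = refl
All-<⇒elemᵇ-false (a<x ∷ a<A) rewrite ≢⇒≡ᵇ-false _ _ (<⇒≢ a<x) = All-<⇒elemᵇ-false a<A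

All->⇒elemᵇ-false : ∀ {a A} → All (_< a) A → elemᵇ a A ≡ false
All->⇒elemᵇ-false []          = refl
All->⇒elemᵇ-false (x<a ∷ A<a) rewrite ≢⇒≡ᵇ-false _ _ (>⇒≢ x<a) = All->⇒elemᵇ-false A<a

elemᵇ-filterᵇ : ∀ (p : ℕ → Bool) v L → elemᵇ v (filterᵇ p L) ≡ (elemᵇ v L ∧ p v)
elemᵇ-filterᵇ p v []      = refl
elemᵇ-filterᵇ p v (x ∷ L) with p x in px
... | true with v ≡ᵇ x in v≡x
...   | true rewrite ≡ᵇ-true⇒≡ v x v≡x = sym px
...   | false = elemᵇ-filterᵇ p v L
elemᵇ-filterᵇ p v (x ∷ L) | false with v ≡ᵇ x in v≡x
...   | true rewrite ≡ᵇ-true⇒≡ v x v≡x =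
  trans (elemᵇ-filterᵇ p x L) (trans (cong (elemᵇ x L ∧_) px) (trans (∧-zeroʳ _) (sym px)))
...   | false = elemᵇ-filterᵇ p v L

elemᵇ-downFrom : ∀ v m → elemᵇ v (downFrom m) ≡ (v <ᵇ m)
elemᵇ-downFrom v zero    = refl
elemᵇ-downFrom v (suc m) rewrite elemᵇ-downFrom v m with <-cmp v m
... | tri< v<m _ _ rewrite ≢⇒≡ᵇ-false v m (<⇒≢ v<m) | <⇒<ᵇ-true v<m | <⇒<ᵇ-true (m<n⇒m<1+n v<m) = refl
... | tri≈ _ refl _ rewrite ≡ᵇ-refl v | <⇒<ᵇ-true (n<1+n v) = refl
... | tri> _ _ v>m rewrite ≢⇒≡ᵇ-false v m (>⇒≢ v>m) | ≤⇒>ᵇ-false (<⇒≤ v>m) | ≤⇒>ᵇ-false v>m = refl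

maxEntry : List ℕ → ℕ
maxEntry []       = 0
maxEntry (x ∷ xs) = x ⊔ maxEntry xs

maxSeq-∷ : ∀ x xs → maxSeq (x ∷ xs) ≡ pos (x ⊔ maxEntry xs)
maxSeq-∷ x []       = refl
maxSeq-∷ x (y ∷ ys) = cong (x ⊔+_) (maxSeq-∷ y ys)
  where
  _⊔+_ : ℕ → ℤ → ℤ
  x ⊔+ pos k    = pos (x ⊔ k)
  x ⊔+ -[1+ k ] = pos x

⊔-<ᵇ : ∀ a b c → (a ⊔ b <ᵇ c) ≡ ((a <ᵇ c) ∧ (b <ᵇ c))
⊔-<ᵇ a b c with ≤-total a b
... | inj₁ a≤b rewrite m≤n⇒m⊔n≡n a≤b with b <ᵇ c in b<c
...   | true  rewrite <⇒<ᵇ-true (≤-<-trans a≤b (<ᵇ-true⇒< b c b<c)) = refl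
...   | false = sym (∧-zeroʳ (a <ᵇ c))
⊔-<ᵇ a b c | inj₂ b≤a rewrite m≥n⇒m⊔n≡m b≤a with a <ᵇ c in a<c
...   | true  rewrite <⇒<ᵇ-true (≤-<-trans b≤a (<ᵇ-true⇒< a c a<c)) = refl
...   | false = refl

all-<ᵇ-∷ : ∀ x xs c → all (_<ᵇ c) (x ∷ xs) ≡ (x ⊔ maxEntry xs <ᵇ c)
all-<ᵇ-∷ x []       c rewrite ⊔-identityʳ x = ∧-identityʳ (x <ᵇ c)
all-<ᵇ-∷ x (y ∷ ys) c rewrite all-<ᵇ-∷ y ys c = sym (⊔-<ᵇ x (y ⊔ maxEntry ys) c)

maxEntry-elemᵇ : ∀ x xs → elemᵇ (x ⊔ maxEntry xs) (x ∷ xs) ≡ true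
maxEntry-elemᵇ x [] rewrite ⊔-identityʳ x | ≡ᵇ-refl x = refl
maxEntry-elemᵇ x (y ∷ ys) with ≤-total x (y ⊔ maxEntry ys)
... | inj₁ x≤ rewrite m≤n⇒m⊔n≡n x≤ | maxEntry-elemᵇ y ys = ∨-zeroʳ _
... | inj₂ x≥ rewrite m≥n⇒m⊔n≡m x≥ | ≡ᵇ-refl x = refl

elemᵇ⇒≤maxEntry : ∀ v σ → elemᵇ v σ ≡ true → v ≤ maxEntry σ
elemᵇ⇒≤maxEntry v (x ∷ xs) v∈σ with v ≡ᵇ x in v≡x
... | true rewrite ≡ᵇ-true⇒≡ v x v≡x = m≤m⊔n x (maxEntry xs)
... | false = ≤-trans (elemᵇ⇒≤maxEntry v xs v∈σ) (m≤n⊔m x (maxEntry xs))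

maxEntry-≡ᵇ : ∀ x xs m → (maxEntry (x ∷ xs) ≡ᵇ m) ≡ (elemᵇ m (x ∷ xs) ∧ all (_<ᵇ suc m) (x ∷ xs))
maxEntry-≡ᵇ x xs m rewrite all-<ᵇ-∷ x xs (suc m) with <-cmp (x ⊔ maxEntry xs) m
... | tri≈ _ refl _ rewrite ≡ᵇ-refl (x ⊔ maxEntry xs) | maxEntry-elemᵇ x xs | <⇒<ᵇ-true (n<1+n (x ⊔ maxEntry xs)) = refl
... | tri< M<m _ _ rewrite ≢⇒≡ᵇ-false _ m (<⇒≢ M<m) with elemᵇ m (x ∷ xs) in m∈σ
...   | true  = ⊥-elim (<⇒≱ M<m (elemᵇ⇒≤maxEntry m (x ∷ xs) m∈σ))
...   | false = refl
maxEntry-≡ᵇ x xs m | tri> _ _ M>m rewrite ≢⇒≡ᵇ-false _ m (>⇒≢ M>m) | ≤⇒>ᵇ-false M>m = sym (∧-zeroʳ _)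

eqℤ-maxSeq : ∀ σ m → eqℤ (maxSeq σ) (pos m) ≡ (elemᵇ m σ ∧ all (_<ᵇ suc m) σ)
eqℤ-maxSeq []       m = refl
eqℤ-maxSeq (x ∷ xs) m = trans (cong (λ z → eqℤ z (pos m)) (maxSeq-∷ x xs)) (maxEntry-≡ᵇ x xs m)

-- Avoiding 000 and 010

isPattern : List ℕ → Bool
isPattern s = orderIso pat000 s ∨ orderIso pat010 s

occurs : ℕ → ℕ → ℕ → Bool
occurs x y z = isPattern (x ∷ y ∷ z ∷ [])

occurs-spec : ∀ x y z → occurs x y z ≡ ((x ≡ᵇ z) ∧ not (y <ᵇ x))
occurs-spec x y z with <-cmp x z
... | tri< x<z _ _ rewrite <⇒<ᵇ-true x<z | ≢⇒≡ᵇ-false x z (<⇒≢ x<z)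
  | ∧-zeroʳ (not (x <ᵇ y) ∧ (x ≡ᵇ y)) | ∧-zeroʳ ((x <ᵇ y) ∧ not (x ≡ᵇ y)) = refl
... | tri> _ _ x>z rewrite ≤⇒>ᵇ-false (<⇒≤ x>z) | ≢⇒≡ᵇ-false x z (>⇒≢ x>z)
  | ∧-zeroʳ (not (x <ᵇ y) ∧ (x ≡ᵇ y)) | ∧-zeroʳ ((x <ᵇ y) ∧ not (x ≡ᵇ y)) = refl
... | tri≈ _ refl _ rewrite ≤⇒>ᵇ-false (≤-refl {x}) | ≡ᵇ-refl x with <-cmp x y
...   | tri< x<y _ _ rewrite <⇒<ᵇ-true x<y | ≢⇒≡ᵇ-false x y (<⇒≢ x<y) | ≤⇒>ᵇ-false (<⇒≤ x<y) | ≢⇒≡ᵇ-false y x (>⇒≢ x<y) = refl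
...   | tri≈ _ refl _ rewrite ≤⇒>ᵇ-false (≤-refl {x}) | ≡ᵇ-refl x = refl
...   | tri> _ _ x>y rewrite ≤⇒>ᵇ-false (<⇒≤ x>y) | ≢⇒≡ᵇ-false x y (>⇒≢ x>y) | <⇒<ᵇ-true x>y = refl

occurs-< : ∀ {x y} → x < y → occurs x y x ≡ true
occurs-< {x} {y} x<y rewrite occurs-spec x y x | ≡ᵇ-refl x | ≤⇒>ᵇ-false (<⇒≤ x<y) = refl

occursAfter : ℕ → List ℕ → Bool
occursAfter x []       = false
occursAfter x (y ∷ ys) = any (occurs x y) ys ∨ occursAfter x ys

patternFree : List ℕ → Bool
patternFree []       = true
patternFree (x ∷ xs) = not (occursAfter x xs) ∧ patternFree xs

any-isPattern-subseqs₁ : ∀ x y ys → any (λ s → isPattern (x ∷ y ∷ s)) (subseqs 1 ys) ≡ any (occurs x y) ys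
any-isPattern-subseqs₁ x y []       = refl
any-isPattern-subseqs₁ x y (z ∷ zs) = cong (occurs x y z ∨_) (any-isPattern-subseqs₁ x y zs)

any-isPattern-subseqs₂ : ∀ x xs → any (λ s → isPattern (x ∷ s)) (subseqs 2 xs) ≡ occursAfter x xs
any-isPattern-subseqs₂ x []       = refl
any-isPattern-subseqs₂ x (y ∷ ys) = begin
  any (λ s → isPattern (x ∷ s)) (map (y ∷_) (subseqs 1 ys) ++ subseqs 2 ys)
    ≡⟨ any-++ _ (map (y ∷_) (subseqs 1 ys)) (subseqs 2 ys) ⟩
  any (λ s → isPattern (x ∷ s)) (map (y ∷_) (subseqs 1 ys)) ∨ any (λ s → isPattern (x ∷ s)) (subseqs 2 ys)
    ≡⟨ cong₂ _∨_ (trans (any-map _ (y ∷_) (subseqs 1 ys)) (any-isPattern-subseqs₁ x y ys)) (any-isPattern-subseqs₂ x ys) ⟩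
  any (occurs x y) ys ∨ occursAfter x ys ∎
  where open ≡-Reasoning

any-isPattern-subseqs₃ : ∀ σ → not (any isPattern (subseqs 3 σ)) ≡ patternFree σ
any-isPattern-subseqs₃ []       = refl
any-isPattern-subseqs₃ (x ∷ xs) = begin
  not (any isPattern (map (x ∷_) (subseqs 2 xs) ++ subseqs 3 xs))
    ≡⟨ cong not (any-++ isPattern (map (x ∷_) (subseqs 2 xs)) (subseqs 3 xs)) ⟩
  not (any isPattern (map (x ∷_) (subseqs 2 xs)) ∨ any isPattern (subseqs 3 xs))
    ≡⟨ cong (λ b → not (b ∨ any isPattern (subseqs 3 xs))) (trans (any-map isPattern (x ∷_) (subseqs 2 xs)) (any-isPattern-subseqs₂ x xs)) ⟩
  not (occursAfter x xs ∨ any isPattern (subseqs 3 xs))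
    ≡⟨ deMorgan₂ (occursAfter x xs) _ ⟩
  not (occursAfter x xs) ∧ not (any isPattern (subseqs 3 xs))
    ≡⟨ cong (not (occursAfter x xs) ∧_) (any-isPattern-subseqs₃ xs) ⟩
  not (occursAfter x xs) ∧ patternFree xs ∎
  where open ≡-Reasoning

avoids000-010≡patternFree : ∀ σ → avoids000-010 σ ≡ patternFree σ
avoids000-010≡patternFree σ = begin
  not (any (orderIso pat000) (subseqs 3 σ)) ∧ not (any (orderIso pat010) (subseqs 3 σ))
    ≡⟨ deMorgan₂ (any (orderIso pat000) (subseqs 3 σ)) (any (orderIso pat010) (subseqs 3 σ)) ⟨
  not (any (orderIso pat000) (subseqs 3 σ) ∨ any (orderIso pat010) (subseqs 3 σ))
    ≡⟨ cong not (any-∨ (orderIso pat000) (orderIso pat010) (subseqs 3 σ)) ⟩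
  not (any isPattern (subseqs 3 σ))
    ≡⟨ any-isPattern-subseqs₃ σ ⟩
  patternFree σ ∎
  where open ≡-Reasoning

module _ {g : ℕ → ℕ} (g-mono : g Preserves _<_ ⟶ _<_) where

  strictMono-<ᵇ : ∀ a b → (g a <ᵇ g b) ≡ (a <ᵇ b)
  strictMono-<ᵇ a b with <-cmp a b
  ... | tri< a<b _ _ rewrite <⇒<ᵇ-true a<b = <⇒<ᵇ-true (g-mono a<b)
  ... | tri≈ _ refl _ rewrite ≤⇒>ᵇ-false (≤-refl {a}) = ≤⇒>ᵇ-false (≤-refl {g a})
  ... | tri> _ _ a>b rewrite ≤⇒>ᵇ-false (<⇒≤ a>b) = ≤⇒>ᵇ-false (<⇒≤ (g-mono a>b))

  strictMono-≡ᵇ : ∀ a b → (g a ≡ᵇ g b) ≡ (a ≡ᵇ b)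
  strictMono-≡ᵇ a b with <-cmp a b
  ... | tri< a<b _ _ rewrite ≢⇒≡ᵇ-false a b (<⇒≢ a<b) = ≢⇒≡ᵇ-false (g a) (g b) (<⇒≢ (g-mono a<b))
  ... | tri≈ _ refl _ rewrite ≡ᵇ-refl a = ≡ᵇ-refl (g a)
  ... | tri> _ _ a>b rewrite ≢⇒≡ᵇ-false a b (>⇒≢ a>b) = ≢⇒≡ᵇ-false (g a) (g b) (>⇒≢ (g-mono a>b))

  elemᵇ-map : ∀ u w → elemᵇ (g u) (map g w) ≡ elemᵇ u w
  elemᵇ-map u []      = refl
  elemᵇ-map u (x ∷ w) = cong₂ _∨_ (strictMono-≡ᵇ u x) (elemᵇ-map u w)

  occurs-map : ∀ x y z → occurs (g x) (g y) (g z) ≡ occurs x y z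
  occurs-map x y z rewrite occurs-spec (g x) (g y) (g z) | occurs-spec x y z =
    cong₂ _∧_ (strictMono-≡ᵇ x z) (cong not (strictMono-<ᵇ y x))

  occursAfter-map : ∀ x ys → occursAfter (g x) (map g ys) ≡ occursAfter x ys
  occursAfter-map x []       = refl
  occursAfter-map x (y ∷ ys) =
    cong₂ _∨_ (trans (any-map _ g ys) (any-cong ys (occurs-map x y))) (occursAfter-map x ys)

  patternFree-map : ∀ σ → patternFree (map g σ) ≡ patternFree σ
  patternFree-map []       = refl
  patternFree-map (x ∷ xs) = cong₂ _∧_ (cong not (occursAfter-map x xs)) (patternFree-map xs)

any-occurs-∉ : ∀ t y B → elemᵇ t B ≡ false → any (occurs t y) B ≡ false
any-occurs-∉ t y B t∉B = trans (any-cong B (occurs-spec t y)) (go B t∉B)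
  where
  go : ∀ B → elemᵇ t B ≡ false → any (λ z → (t ≡ᵇ z) ∧ not (y <ᵇ t)) B ≡ false
  go []      _ = refl
  go (z ∷ B) t∉ with t ≡ᵇ z
  go (z ∷ B) () | true
  ... | false = go B t∉

occursAfter-∉ : ∀ t B → elemᵇ t B ≡ false → occursAfter t B ≡ false
occursAfter-∉ t []      _ = refl
occursAfter-∉ t (y ∷ B) t∉ rewrite any-occurs-∉ t y B (∨-falseʳ t∉) = occursAfter-∉ t B (∨-falseʳ t∉)

occursAfter-++-∉ : ∀ t A B → elemᵇ t B ≡ false → occursAfter t (A ++ B) ≡ occursAfter t A
occursAfter-++-∉ t []      B t∉B = occursAfter-∉ t B t∉B
occursAfter-++-∉ t (y ∷ A) B t∉B
  rewrite any-++ (occurs t y) A B | any-occurs-∉ t y B t∉B | ∨-identityʳ (any (occurs t y) A) | occursAfter-++-∉ t A B t∉B = refl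

occursAfter-++ʳ : ∀ t A B → occursAfter t B ≡ true → occursAfter t (A ++ B) ≡ true
occursAfter-++ʳ t []      B e = e
occursAfter-++ʳ t (y ∷ A) B e rewrite occursAfter-++ʳ t A B e = ∨-zeroʳ _

-- A letter t < m shared by τ and ω would form the pattern t m t.
patternFree-++-∷ : ∀ m τ ω → all (_<ᵇ m) τ ≡ true →
  patternFree (τ ++ m ∷ ω) ≡ (patternFree τ ∧ patternFree (m ∷ ω) ∧ all (λ t → not (elemᵇ t ω)) τ)
patternFree-++-∷ m []      ω _ = sym (∧-identityʳ _)
patternFree-++-∷ m (t ∷ τ) ω h with t <ᵇ m in t<m
patternFree-++-∷ m (t ∷ τ) ω () | false
... | true with elemᵇ t ω in t∈ω
... | true
  rewrite occursAfter-++ʳ t τ (m ∷ ω) (cong (_∨ occursAfter t ω) (elemᵇ⇒any (occurs t m) t ω t∈ω (occurs-< (<ᵇ-true⇒< t m t<m))))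
        | ∧-zeroʳ (patternFree (m ∷ ω)) | ∧-zeroʳ (not (occursAfter t τ) ∧ patternFree τ) = refl
... | false
  rewrite occursAfter-++-∉ t τ (m ∷ ω) (trans (cong (_∨ elemᵇ t ω) (≢⇒≡ᵇ-false t m (<⇒≢ (<ᵇ-true⇒< t m t<m)))) t∈ω)
        | patternFree-++-∷ m τ ω h = sym (∧-assoc (not (occursAfter t τ)) (patternFree τ) _)

-- Distinct letters

#distinct : List ℕ → ℕ
#distinct []       = 0
#distinct (x ∷ xs) = 𝟙 (not (elemᵇ x xs)) + #distinct xs

∑-filter-not : ∀ (p : ℕ → Bool) L (h : ℕ → ℕ) →
  ∑ (filter (λ y → ¬? (T? (p y))) L) h ≡ ∑[ y ∈ L ] 𝟙 (not (p y)) * h y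
∑-filter-not p []      h = refl
∑-filter-not p (y ∷ L) h with p y
... | true  = ∑-filter-not p L h
... | false = cong₂ _+_ (sym (*-identityˡ (h y))) (∑-filter-not p L h)

∑-deduplicate-𝟙≡ᵇ : ∀ x xs → ∑[ y ∈ deduplicateᵇ _≡ᵇ_ xs ] 𝟙 (x ≡ᵇ y) ≡ 𝟙 (elemᵇ x xs)
∑-deduplicate-𝟙≡ᵇ x []       = refl
∑-deduplicate-𝟙≡ᵇ x (z ∷ zs) with x ≡ᵇ z in x≡z
... | true rewrite ≡ᵇ-true⇒≡ x z x≡z =
  cong suc (trans (∑-filter-not (z ≡ᵇ_) (deduplicateᵇ _≡ᵇ_ zs) (λ y → 𝟙 (z ≡ᵇ y)))
                  (∑-≡0 (deduplicateᵇ _≡ᵇ_ zs) (λ y → 𝟙-not*𝟙 (z ≡ᵇ y))))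
  where
  𝟙-not*𝟙 : ∀ b → 𝟙 (not b) * 𝟙 b ≡ 0
  𝟙-not*𝟙 true  = refl
  𝟙-not*𝟙 false = refl
... | false = trans (∑-filter-not (z ≡ᵇ_) (deduplicateᵇ _≡ᵇ_ zs) (λ y → 𝟙 (x ≡ᵇ y)))
                    (trans (∑-cong (deduplicateᵇ _≡ᵇ_ zs) drop-z) (∑-deduplicate-𝟙≡ᵇ x zs))
  where
  drop-z : ∀ y → 𝟙 (not (z ≡ᵇ y)) * 𝟙 (x ≡ᵇ y) ≡ 𝟙 (x ≡ᵇ y)
  drop-z y with x ≡ᵇ y in x≡y
  ... | false = *-zeroʳ (𝟙 (not (z ≡ᵇ y)))
  ... | true rewrite sym (≡ᵇ-true⇒≡ x y x≡y) | ≡ᵇ-sym z x | x≡z = refl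

distinct≡#distinct : ∀ σ → distinct σ ≡ #distinct σ
distinct≡#distinct []       = refl
distinct≡#distinct (x ∷ xs) = begin
  suc (length (filter (λ y → ¬? (T? (x ≡ᵇ y))) dxs)) ≡⟨ cong suc others ⟩
  suc (∑[ y ∈ dxs ] 𝟙 (not (x ≡ᵇ y)))                ≡⟨ suc-lemma (elemᵇ x xs) complement ⟩
  𝟙 (not (elemᵇ x xs)) + #distinct xs                ∎
  where
  open ≡-Reasoning
  dxs = deduplicateᵇ _≡ᵇ_ xs
  others : length (filter (λ y → ¬? (T? (x ≡ᵇ y))) dxs) ≡ ∑[ y ∈ dxs ] 𝟙 (not (x ≡ᵇ y))
  others = trans (length≡∑1 (filter (λ y → ¬? (T? (x ≡ᵇ y))) dxs))
                 (trans (∑-filter-not (x ≡ᵇ_) dxs (λ _ → 1)) (∑-cong dxs (λ y → *-identityʳ _)))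
  complement : (∑[ y ∈ dxs ] 𝟙 (not (x ≡ᵇ y))) + 𝟙 (elemᵇ x xs) ≡ #distinct xs
  complement = begin
    (∑[ y ∈ dxs ] 𝟙 (not (x ≡ᵇ y))) + 𝟙 (elemᵇ x xs)
      ≡⟨ cong ((∑[ y ∈ dxs ] 𝟙 (not (x ≡ᵇ y))) +_) (∑-deduplicate-𝟙≡ᵇ x xs) ⟨
    (∑[ y ∈ dxs ] 𝟙 (not (x ≡ᵇ y))) + (∑[ y ∈ dxs ] 𝟙 (x ≡ᵇ y))
      ≡⟨ ∑-+ dxs _ _ ⟨
    ∑[ y ∈ dxs ] (𝟙 (not (x ≡ᵇ y)) + 𝟙 (x ≡ᵇ y))
      ≡⟨ ∑-cong dxs (λ y → 𝟙-not+𝟙 (x ≡ᵇ y)) ⟩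
    ∑[ y ∈ dxs ] 1
      ≡⟨ length≡∑1 dxs ⟨
    distinct xs
      ≡⟨ distinct≡#distinct xs ⟩
    #distinct xs ∎
  suc-lemma : ∀ {a D} e → a + 𝟙 e ≡ D → suc a ≡ 𝟙 (not e) + D
  suc-lemma {a} true  a+1≡D = trans (+-comm 1 a) a+1≡D
  suc-lemma {a} false a+0≡D = cong suc (trans (sym (+-identityʳ a)) a+0≡D)

#distinct-∷-positive : ∀ x xs → 1 ≤ #distinct (x ∷ xs)
#distinct-∷-positive x []       = ≤-refl
#distinct-∷-positive x (y ∷ ys) with elemᵇ x (y ∷ ys)
... | true  = #distinct-∷-positive y ys
... | false = s≤s z≤n

#distinct-++ : ∀ A B → all (λ a → not (elemᵇ a B)) A ≡ true → #distinct (A ++ B) ≡ #distinct A + #distinct B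
#distinct-++ []      B _ = refl
#distinct-++ (a ∷ A) B h with elemᵇ a B in a∈B
#distinct-++ (a ∷ A) B () | true
... | false rewrite elemᵇ-++ a A B | a∈B | ∨-identityʳ (elemᵇ a A) | #distinct-++ A B h =
  sym (+-assoc (𝟙 (not (elemᵇ a A))) (#distinct A) (#distinct B))

#distinct≡∑ : ∀ K σ → all (_<ᵇ K) σ ≡ true → #distinct σ ≡ ∑[ v ∈ upTo K ] 𝟙 (elemᵇ v σ)
#distinct≡∑ K []       _ = sym (∑-zero (upTo K))
#distinct≡∑ K (x ∷ xs) h with x <ᵇ K in x<K
#distinct≡∑ K (x ∷ xs) () | false
... | true = begin
  𝟙 (not (elemᵇ x xs)) + #distinct xs
    ≡⟨ cong₂ _+_ (sym (∑-upTo-δ K x (λ v → 𝟙 (not (elemᵇ v xs))) (<ᵇ-true⇒< x K x<K))) (#distinct≡∑ K xs h) ⟩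
  (∑[ v ∈ upTo K ] 𝟙 (v ≡ᵇ x) * 𝟙 (not (elemᵇ v xs))) + (∑[ v ∈ upTo K ] 𝟙 (elemᵇ v xs))
    ≡⟨ ∑-+ (upTo K) _ _ ⟨
  ∑[ v ∈ upTo K ] (𝟙 (v ≡ᵇ x) * 𝟙 (not (elemᵇ v xs)) + 𝟙 (elemᵇ v xs))
    ≡⟨ ∑-cong (upTo K) (λ v → 𝟙-∨ (v ≡ᵇ x) (elemᵇ v xs)) ⟩
  ∑[ v ∈ upTo K ] 𝟙 ((v ≡ᵇ x) ∨ elemᵇ v xs) ∎
  where
  open ≡-Reasoning
  𝟙-∨ : ∀ a b → 𝟙 a * 𝟙 (not b) + 𝟙 b ≡ 𝟙 (a ∨ b)
  𝟙-∨ true  true  = refl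
  𝟙-∨ true  false = refl
  𝟙-∨ false true  = refl
  𝟙-∨ false false = refl

#distinct-map : ∀ {g} → g Preserves _<_ ⟶ _<_ → ∀ σ → #distinct (map g σ) ≡ #distinct σ
#distinct-map g-mono []       = refl
#distinct-map g-mono (x ∷ xs) rewrite elemᵇ-map g-mono x xs | #distinct-map g-mono xs = refl

disjoint-sym : ∀ τ ω → all (λ t → not (elemᵇ t ω)) τ ≡ all (λ v → not (elemᵇ v τ)) ω
disjoint-sym τ ω = begin
  all (λ t → not (elemᵇ t ω)) τ                 ≡⟨ all-not (λ t → elemᵇ t ω) τ ⟩
  not (any (λ t → any (t ≡ᵇ_) ω) τ)            ≡⟨ cong not (any-comm _≡ᵇ_ τ ω) ⟩
  not (any (λ v → any (λ t → t ≡ᵇ v) τ) ω)     ≡⟨ cong not (any-cong ω (λ v → any-cong τ (λ t → ≡ᵇ-sym t v))) ⟩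
  not (any (λ v → elemᵇ v τ) ω)                 ≡⟨ all-not (λ v → elemᵇ v τ) ω ⟨
  all (λ v → not (elemᵇ v τ)) ω                 ∎
  where open ≡-Reasoning

#distinct-full : ∀ r ω → all (_<ᵇ suc r) ω ≡ true → all (λ u → elemᵇ u ω) (upTo r) ≡ true → #distinct (r ∷ ω) ≡ suc r
#distinct-full r ω ω≤r all∈ω = begin
  #distinct (r ∷ ω)                           ≡⟨ #distinct≡∑ (suc r) (r ∷ ω) (trans (cong (_∧ all (_<ᵇ suc r) ω) (<⇒<ᵇ-true (n<1+n r))) ω≤r) ⟩
  ∑[ v ∈ upTo (suc r) ] 𝟙 (elemᵇ v (r ∷ ω))  ≡⟨ ∑-upTo-cong (suc r) occurs-in ⟩
  ∑[ _ ∈ upTo (suc r) ] 1                     ≡⟨ trans (sym (length≡∑1 (upTo (suc r)))) (length-upTo (suc r)) ⟩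
  suc r                                       ∎
  where
  open ≡-Reasoning
  occurs-in : ∀ v → v < suc r → 𝟙 (elemᵇ v (r ∷ ω)) ≡ 1
  occurs-in v v<1+r with m<1+n⇒m<n∨m≡n v<1+r
  ... | inj₁ v<r  rewrite all-upTo-true (λ u → elemᵇ u ω) r all∈ω v v<r = cong 𝟙 (∨-zeroʳ (v ≡ᵇ r))
  ... | inj₂ refl rewrite ≡ᵇ-refl v = refl

-- Counting words

∑-words-suc : ∀ L K (f : List ℕ → ℕ) → ∑ (words (suc L) K) f ≡ ∑[ v ∈ upTo K ] ∑[ w ∈ words L K ] f (v ∷ w)
∑-words-suc L K f = begin
  ∑ (concatMap (λ w → map (_∷ w) (upTo K)) (words L K)) f ≡⟨ ∑-concatMap (words L K) _ f ⟩
  ∑[ w ∈ words L K ] ∑ (map (_∷ w) (upTo K)) f          ≡⟨ ∑-cong (words L K) (λ w → ∑-map (upTo K) (_∷ w) f) ⟩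
  ∑[ w ∈ words L K ] ∑[ v ∈ upTo K ] f (v ∷ w)          ≡⟨ ∑-comm (words L K) (upTo K) (λ w v → f (v ∷ w)) ⟩
  ∑[ v ∈ upTo K ] ∑[ w ∈ words L K ] f (v ∷ w)          ∎
  where open ≡-Reasoning

∑-words-cong : ∀ L K {f g : List ℕ → ℕ} → (∀ ω → all (_<ᵇ K) ω ≡ true → f ω ≡ g ω) →
  ∑ (words L K) f ≡ ∑ (words L K) g
∑-words-cong zero    K f≗g = cong (_+ 0) (f≗g [] refl)
∑-words-cong (suc L) K {f} {g} f≗g = begin
  ∑ (words (suc L) K) f                        ≡⟨ ∑-words-suc L K f ⟩
  ∑[ v ∈ upTo K ] ∑[ w ∈ words L K ] f (v ∷ w) ≡⟨ ∑-upTo-cong K (λ v v<K → ∑-words-cong L K (λ w w<K →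
                                                     f≗g (v ∷ w) (trans (cong (_∧ all (_<ᵇ K) w) (<⇒<ᵇ-true v<K)) w<K))) ⟩
  ∑[ v ∈ upTo K ] ∑[ w ∈ words L K ] g (v ∷ w) ≡⟨ ∑-words-suc L K g ⟨
  ∑ (words (suc L) K) g                        ∎
  where open ≡-Reasoning

∑-upTo-elemᵇ : ∀ K {A} (F : ℕ → ℕ) → AllPairs _<_ A → All (_< K) A → ∑[ v ∈ upTo K ] 𝟙 (elemᵇ v A) * F v ≡ ∑ A F
∑-upTo-elemᵇ K F []                     []           = ∑-zero (upTo K)
∑-upTo-elemᵇ K {a ∷ A} F (a<A ∷ A-incr) (a<K ∷ A<K) = begin
  ∑[ v ∈ upTo K ] 𝟙 ((v ≡ᵇ a) ∨ elemᵇ v A) * F v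
    ≡⟨ ∑-cong (upTo K) split ⟩
  ∑[ v ∈ upTo K ] (𝟙 (v ≡ᵇ a) * F v + 𝟙 (elemᵇ v A) * F v)
    ≡⟨ ∑-+ (upTo K) _ _ ⟩
  (∑[ v ∈ upTo K ] 𝟙 (v ≡ᵇ a) * F v) + (∑[ v ∈ upTo K ] 𝟙 (elemᵇ v A) * F v)
    ≡⟨ cong₂ _+_ (∑-upTo-δ K a F a<K) (∑-upTo-elemᵇ K F A-incr A<K) ⟩
  F a + ∑ A F ∎
  where
  open ≡-Reasoning
  split : ∀ v → 𝟙 ((v ≡ᵇ a) ∨ elemᵇ v A) * F v ≡ 𝟙 (v ≡ᵇ a) * F v + 𝟙 (elemᵇ v A) * F v
  split v with v ≡ᵇ a in v≡a
  ... | true rewrite ≡ᵇ-true⇒≡ v a v≡a | All-<⇒elemᵇ-false a<A = sym (+-identityʳ _)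
  ... | false = refl

∑-words-relabel : ∀ L K n {A} (g : ℕ → ℕ) (R : List ℕ → Bool) → AllPairs _<_ A → All (_< K) A → map g (upTo n) ≡ A →
  ∑[ ω ∈ words L K ] 𝟙 (all (λ v → elemᵇ v A) ω ∧ R ω) ≡ ∑[ ω ∈ words L n ] 𝟙 (R (map g ω))
∑-words-relabel zero    K n g R A-incr A<K g[n]≡A = refl
∑-words-relabel (suc L) K n {A} g R A-incr A<K g[n]≡A = begin
  ∑[ ω ∈ words (suc L) K ] 𝟙 (all (λ v → elemᵇ v A) ω ∧ R ω)
    ≡⟨ ∑-words-suc L K _ ⟩
  ∑[ v ∈ upTo K ] ∑[ w ∈ words L K ] 𝟙 ((elemᵇ v A ∧ all (λ v → elemᵇ v A) w) ∧ R (v ∷ w))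
    ≡⟨ ∑-cong (upTo K) (λ v → trans (∑-cong (words L K) (λ w → trans (cong 𝟙 (∧-assoc (elemᵇ v A) _ _)) (𝟙-∧ (elemᵇ v A) _)))
                                    (∑-*ˡ (words L K) (𝟙 (elemᵇ v A)) _)) ⟩
  ∑[ v ∈ upTo K ] 𝟙 (elemᵇ v A) * (∑[ w ∈ words L K ] 𝟙 (all (λ v → elemᵇ v A) w ∧ R (v ∷ w)))
    ≡⟨ ∑-cong (upTo K) (λ v → cong (𝟙 (elemᵇ v A) *_) (∑-words-relabel L K n g (λ w → R (v ∷ w)) A-incr A<K g[n]≡A)) ⟩
  ∑[ v ∈ upTo K ] 𝟙 (elemᵇ v A) * (∑[ w ∈ words L n ] 𝟙 (R (v ∷ map g w)))
    ≡⟨ ∑-upTo-elemᵇ K _ A-incr A<K ⟩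
  ∑[ v ∈ A ] ∑[ w ∈ words L n ] 𝟙 (R (v ∷ map g w))
    ≡⟨ cong (λ B → ∑[ v ∈ B ] ∑[ w ∈ words L n ] 𝟙 (R (v ∷ map g w))) g[n]≡A ⟨
  ∑[ v ∈ map g (upTo n) ] ∑[ w ∈ words L n ] 𝟙 (R (v ∷ map g w))
    ≡⟨ ∑-map (upTo n) g _ ⟩
  ∑[ u ∈ upTo n ] ∑[ w ∈ words L n ] 𝟙 (R (g u ∷ map g w))
    ≡⟨ ∑-words-suc L n _ ⟨
  ∑[ ω ∈ words (suc L) n ] 𝟙 (R (map g ω)) ∎
  where open ≡-Reasoning

-- The u-th letter of Y ++ [ m ], continued by m + 1, m + 2, … to be strictly monotone on all of ℕ.
letterAt : List ℕ → ℕ → ℕ → ℕ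
letterAt []      m u       = m + u
letterAt (y ∷ Y) m zero    = y
letterAt (y ∷ Y) m (suc u) = letterAt Y m u

letterAt-length : ∀ Y m → letterAt Y m (length Y) ≡ m
letterAt-length []      m = +-identityʳ m
letterAt-length (y ∷ Y) m = letterAt-length Y m

applyUpTo-letterAt : ∀ Y m → applyUpTo (letterAt Y m) (length Y) ≡ Y
applyUpTo-letterAt []      m = refl
applyUpTo-letterAt (y ∷ Y) m = cong (y ∷_) (applyUpTo-letterAt Y m)

applyUpTo-letterAt-suc : ∀ Y m → applyUpTo (letterAt Y m) (suc (length Y)) ≡ Y ++ [ m ]
applyUpTo-letterAt-suc []      m = cong [_] (+-identityʳ m)
applyUpTo-letterAt-suc (y ∷ Y) m = cong (y ∷_) (applyUpTo-letterAt-suc Y m)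

letterAt-above : ∀ {y} Y m → All (y <_) (Y ++ [ m ]) → ∀ u → y < letterAt Y m u
letterAt-above []      m (y<m ∷ []) u       = <-≤-trans y<m (m≤m+n m u)
letterAt-above (_ ∷ Y) m (y<y′ ∷ _) zero    = y<y′
letterAt-above (_ ∷ Y) m (_ ∷ y<Y) (suc u) = letterAt-above Y m y<Y u

letterAt-strictMono : ∀ Y m → AllPairs _<_ (Y ++ [ m ]) → letterAt Y m Preserves _<_ ⟶ _<_
letterAt-strictMono []      m _               a<b                     = +-monoʳ-< m a<b
letterAt-strictMono (y ∷ Y) m (y<Y ∷ _)       {zero}  {suc b} _       = letterAt-above Y m y<Y b
letterAt-strictMono (y ∷ Y) m (_ ∷ Y-incr)    {suc a} {suc b} (s≤s a<b) = letterAt-strictMono Y m Y-incr a<b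

increasing-∷ʳ-bounded : ∀ Y m → AllPairs _<_ (Y ++ [ m ]) → All (_< suc m) (Y ++ [ m ])
increasing-∷ʳ-bounded []      m _             = ≤-refl ∷ []
increasing-∷ʳ-bounded (y ∷ Y) m (y<Y ∷ Y-incr) = m<n⇒m<1+n (proj₂ (All.∷ʳ⁻ y<Y)) ∷ increasing-∷ʳ-bounded Y m Y-incr

𝔟-suc≡∑ : ∀ L r → 𝔟 (suc L) (suc r) ≡ ∑[ w ∈ words L (suc r) ] 𝟙 (patternFree (r ∷ w) ∧ all (λ u → elemᵇ u w) (upTo r))
𝔟-suc≡∑ L r = begin
  𝔟 (suc L) (suc r)
    ≡⟨ length-filterᵇ≡∑ _ (words (suc L) (suc r)) ⟩
  ∑[ ω ∈ words (suc L) (suc r) ] 𝟙 (avoids000-010 ω ∧ all (λ u → elemᵇ u ω) (upTo (suc r)) ∧ firstIs r ω)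
    ≡⟨ ∑-words-suc L (suc r) _ ⟩
  ∑[ v ∈ upTo (suc r) ] ∑[ w ∈ words L (suc r) ] 𝟙 (avoids000-010 (v ∷ w) ∧ all (λ u → elemᵇ u (v ∷ w)) (upTo (suc r)) ∧ (v ≡ᵇ r))
    ≡⟨ ∑-cong (upTo (suc r)) (λ v → trans (∑-cong (words L (suc r)) (λ w → first-letter v w)) (∑-*ˡ (words L (suc r)) (𝟙 (v ≡ᵇ r)) _)) ⟩
  ∑[ v ∈ upTo (suc r) ] 𝟙 (v ≡ᵇ r) * (∑[ w ∈ words L (suc r) ] 𝟙 (patternFree (v ∷ w) ∧ all (λ u → elemᵇ u (v ∷ w)) (upTo (suc r))))
    ≡⟨ ∑-upTo-δ (suc r) r _ ≤-refl ⟩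
  ∑[ w ∈ words L (suc r) ] 𝟙 (patternFree (r ∷ w) ∧ all (λ u → elemᵇ u (r ∷ w)) (upTo (suc r)))
    ≡⟨ ∑-cong (words L (suc r)) (λ w → cong (λ b → 𝟙 (patternFree (r ∷ w) ∧ b)) (all-letters w)) ⟩
  ∑[ w ∈ words L (suc r) ] 𝟙 (patternFree (r ∷ w) ∧ all (λ u → elemᵇ u w) (upTo r)) ∎
  where
  open ≡-Reasoning
  first-letter : ∀ v w → 𝟙 (avoids000-010 (v ∷ w) ∧ all (λ u → elemᵇ u (v ∷ w)) (upTo (suc r)) ∧ (v ≡ᵇ r))
                       ≡ 𝟙 (v ≡ᵇ r) * 𝟙 (patternFree (v ∷ w) ∧ all (λ u → elemᵇ u (v ∷ w)) (upTo (suc r)))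
  first-letter v w rewrite avoids000-010≡patternFree (v ∷ w) with v ≡ᵇ r
  ... | true  rewrite ∧-identityʳ (all (λ u → elemᵇ u (v ∷ w)) (upTo (suc r))) = sym (+-identityʳ _)
  ... | false rewrite ∧-zeroʳ (all (λ u → elemᵇ u (v ∷ w)) (upTo (suc r))) | ∧-zeroʳ (patternFree (v ∷ w)) = refl
  all-letters : ∀ w → all (λ u → elemᵇ u (r ∷ w)) (upTo (suc r)) ≡ all (λ u → elemᵇ u w) (upTo r)
  all-letters w rewrite all-upTo-suc (λ u → elemᵇ u (r ∷ w)) r | ≡ᵇ-refl r =
    trans (∧-identityʳ _) (all-upTo-cong _ _ r (λ u u<r → cong (_∨ elemᵇ u w) (≢⇒≡ᵇ-false u r (<⇒≢ u<r))))

-- The number of ways to choose the k ∸ 1 ∸ y letters still missing among x candidates; the guard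
-- excludes k ≤ y, where the truncated subtraction would wrongly give x C 0 = 1.
pick : ℕ → ℕ → ℕ → ℕ
pick x y k = if y <ᵇ k then x C (k ∸ 1 ∸ y) else 0

pick-positive : ∀ x {k} → 0 < k → pick x 0 k ≡ x C (k ∸ 1)
pick-positive x {suc k} _ = refl

pick-pascal : ∀ x y k → pick (suc x) y k ≡ pick x y k + pick x (suc y) k
pick-pascal x y zero    = refl
pick-pascal x y (suc k) with <-cmp y k
... | tri< y<k _ _ rewrite <⇒<ᵇ-true (m<n⇒m<1+n y<k) | <⇒<ᵇ-true y<k | ∸-suc y<k =
  sym (trans (+-comm (x C suc (k ∸ suc y)) _) (nCk+nC[k+1]≡[n+1]C[k+1] x (k ∸ suc y)))
... | tri≈ _ refl _ rewrite <⇒<ᵇ-true (n<1+n y) | ≤⇒>ᵇ-false (≤-refl {y}) | n∸n≡0 y = refl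
... | tri> _ _ y>k rewrite ≤⇒>ᵇ-false y>k | ≤⇒>ᵇ-false (m<n⇒m<1+n y>k) = refl

pick-zero : ∀ y k → pick 0 y k ≡ 𝟙 (suc y ≡ᵇ k)
pick-zero y zero    = refl
pick-zero y (suc k) with <-cmp y k
... | tri< y<k _ _ rewrite <⇒<ᵇ-true (m<n⇒m<1+n y<k) | ∸-suc y<k | ≢⇒≡ᵇ-false y k (<⇒≢ y<k) = refl
... | tri≈ _ refl _ rewrite <⇒<ᵇ-true (n<1+n y) | n∸n≡0 y | ≡ᵇ-refl y = refl
... | tri> _ _ y>k rewrite ≤⇒>ᵇ-false y>k | ≢⇒≡ᵇ-false y k (>⇒≢ y>k) = refl

allowed : List ℕ → List ℕ → ℕ → ℕ → Bool
allowed X Y m v = (v ≡ᵇ m) ∨ elemᵇ v X ∨ elemᵇ v Y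

-- ω is a word in the optional letters X, the mandatory letters Y (all of which occur) and m,
-- such that m ∷ ω is pattern-free with k distinct letters.
admissible : ℕ → ℕ → List ℕ → List ℕ → List ℕ → Bool
admissible m k X Y ω = patternFree (m ∷ ω) ∧ all (allowed X Y m) ω ∧ all (λ y → elemᵇ y ω) Y ∧ (#distinct (m ∷ ω) ≡ᵇ k)

covering : ℕ → ℕ → List ℕ → List ℕ → Bool
covering m k Y ω = patternFree (m ∷ ω) ∧ all (λ y → elemᵇ y ω) Y ∧ (#distinct (m ∷ ω) ≡ᵇ k)

admissible-[] : ∀ m k Y ω → admissible m k [] Y ω ≡ (all (λ v → elemᵇ v (Y ++ [ m ])) ω ∧ covering m k Y ω)
admissible-[] m k Y ω =
  trans (cong (λ b → patternFree (m ∷ ω) ∧ b ∧ mandatory) (all-cong ω allowed≡elemᵇ))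
        (swap (patternFree (m ∷ ω)) (all (λ v → elemᵇ v (Y ++ [ m ])) ω) mandatory)
  where
  allowed≡elemᵇ : ∀ v → allowed [] Y m v ≡ elemᵇ v (Y ++ [ m ])
  allowed≡elemᵇ v rewrite elemᵇ-++ v Y [ m ] with v ≡ᵇ m | elemᵇ v Y
  ... | true  | true  = refl
  ... | true  | false = refl
  ... | false | true  = refl
  ... | false | false = refl
  swap : ∀ a b c → (a ∧ b ∧ c) ≡ (b ∧ a ∧ c)
  swap true  b c = refl
  swap false b c = sym (∧-zeroʳ b)
  mandatory = all (λ y → elemᵇ y ω) Y ∧ (#distinct (m ∷ ω) ≡ᵇ k)

covering-letterAt : ∀ m k Y ω → AllPairs _<_ (Y ++ [ m ]) → all (_<ᵇ suc (length Y)) ω ≡ true →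
  covering m k Y (map (letterAt Y m) ω)
    ≡ (patternFree (length Y ∷ ω) ∧ all (λ u → elemᵇ u ω) (upTo (length Y)) ∧ (suc (length Y) ≡ᵇ k))
covering-letterAt m k Y ω Y∷ʳm-incr ω≤r = trans (cong₂ _∧_ pattern-free (cong₂ _∧_ mandatory distinct-letters)) all-letters-used
  where
  open ≡-Reasoning
  r = length Y
  g = letterAt Y m
  g-mono = letterAt-strictMono Y m Y∷ʳm-incr
  m≡g[r] : m ≡ g r
  m≡g[r] = sym (letterAt-length Y m)
  pattern-free : patternFree (m ∷ map g ω) ≡ patternFree (r ∷ ω)
  pattern-free = trans (cong (λ z → patternFree (z ∷ map g ω)) m≡g[r]) (patternFree-map g-mono (r ∷ ω))
  distinct-letters : (#distinct (m ∷ map g ω) ≡ᵇ k) ≡ (#distinct (r ∷ ω) ≡ᵇ k)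
  distinct-letters = cong (_≡ᵇ k) (trans (cong (λ z → #distinct (z ∷ map g ω)) m≡g[r]) (#distinct-map g-mono (r ∷ ω)))
  mandatory : all (λ y → elemᵇ y (map g ω)) Y ≡ all (λ u → elemᵇ u ω) (upTo r)
  mandatory = begin
    all (λ y → elemᵇ y (map g ω)) Y                ≡⟨ cong (all _) (trans (map-upTo g r) (applyUpTo-letterAt Y m)) ⟨
    all (λ y → elemᵇ y (map g ω)) (map g (upTo r)) ≡⟨ all-map _ g (upTo r) ⟩
    all (λ u → elemᵇ (g u) (map g ω)) (upTo r)     ≡⟨ all-cong (upTo r) (λ u → elemᵇ-map g-mono u ω) ⟩
    all (λ u → elemᵇ u ω) (upTo r)                 ∎
  all-letters-used : (patternFree (r ∷ ω) ∧ all (λ u → elemᵇ u ω) (upTo r) ∧ (#distinct (r ∷ ω) ≡ᵇ k))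
                   ≡ (patternFree (r ∷ ω) ∧ all (λ u → elemᵇ u ω) (upTo r) ∧ (suc r ≡ᵇ k))
  all-letters-used with all (λ u → elemᵇ u ω) (upTo r) in all∈ω
  ... | true  rewrite #distinct-full r ω ω≤r all∈ω = refl
  ... | false = refl

∑-admissible-[] : ∀ L m k Y → AllPairs _<_ (Y ++ [ m ]) →
  ∑[ ω ∈ words L (suc m) ] 𝟙 (admissible m k [] Y ω) ≡ pick 0 (length Y) k * 𝔟 (suc L) k
∑-admissible-[] L m k Y Y∷ʳm-incr = begin
  ∑[ ω ∈ words L (suc m) ] 𝟙 (admissible m k [] Y ω)
    ≡⟨ ∑-cong (words L (suc m)) (λ ω → cong 𝟙 (admissible-[] m k Y ω)) ⟩
  ∑[ ω ∈ words L (suc m) ] 𝟙 (all (λ v → elemᵇ v (Y ++ [ m ])) ω ∧ covering m k Y ω)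
    ≡⟨ ∑-words-relabel L (suc m) (suc r) (letterAt Y m) (covering m k Y) Y∷ʳm-incr (increasing-∷ʳ-bounded Y m Y∷ʳm-incr)
         (trans (map-upTo (letterAt Y m) (suc r)) (applyUpTo-letterAt-suc Y m)) ⟩
  ∑[ ω ∈ words L (suc r) ] 𝟙 (covering m k Y (map (letterAt Y m) ω))
    ≡⟨ ∑-words-cong L (suc r) (λ ω ω≤r → cong 𝟙 (covering-letterAt m k Y ω Y∷ʳm-incr ω≤r)) ⟩
  ∑[ ω ∈ words L (suc r) ] 𝟙 (patternFree (r ∷ ω) ∧ all (λ u → elemᵇ u ω) (upTo r) ∧ (suc r ≡ᵇ k))
    ≡⟨ ∑-cong (words L (suc r)) (λ ω → 𝟙-∧ʳ (patternFree (r ∷ ω)) (all (λ u → elemᵇ u ω) (upTo r)) (suc r ≡ᵇ k)) ⟩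
  ∑[ ω ∈ words L (suc r) ] 𝟙 (suc r ≡ᵇ k) * 𝟙 (P ω)
    ≡⟨ trans (∑-*ˡ (words L (suc r)) (𝟙 (suc r ≡ᵇ k)) (λ ω → 𝟙 (P ω))) (cong (𝟙 (suc r ≡ᵇ k) *_) (sym (𝔟-suc≡∑ L r))) ⟩
  𝟙 (suc r ≡ᵇ k) * 𝔟 (suc L) (suc r)
    ≡⟨ 𝟙-≡ᵇ-subst (𝔟 (suc L)) (suc r) k ⟩
  𝟙 (suc r ≡ᵇ k) * 𝔟 (suc L) k
    ≡⟨ cong (_* 𝔟 (suc L) k) (pick-zero r k) ⟨
  pick 0 r k * 𝔟 (suc L) k ∎
  where
  open ≡-Reasoning
  r = length Y
  P : List ℕ → Bool
  P ω = patternFree (r ∷ ω) ∧ all (λ u → elemᵇ u ω) (upTo r)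

allowed-move : ∀ t X Y m v → allowed (t ∷ X) Y m v ≡ allowed X (t ∷ Y) m v
allowed-move t X Y m v with v ≡ᵇ m | v ≡ᵇ t | elemᵇ v X
... | true  | _     | _     = refl
... | false | true  | true  = refl
... | false | true  | false = refl
... | false | false | true  = refl
... | false | false | false = refl

all-allowed-∉ : ∀ t X Y m ω → elemᵇ t ω ≡ false → all (allowed (t ∷ X) Y m) ω ≡ all (allowed X Y m) ω
all-allowed-∉ t X Y m []      _ = refl
all-allowed-∉ t X Y m (x ∷ ω) t∉ω with t ≡ᵇ x in t≡x
... | false rewrite ≡ᵇ-sym x t | t≡x | all-allowed-∉ t X Y m ω t∉ω = refl

-- Induction on the optional letters: the largest one either is absent from ω or becomes mandatory.
∑-admissible : ∀ L m k X Y → AllPairs _>_ X → AllPairs _<_ (Y ++ [ m ]) → All (λ x → All (x <_) (Y ++ [ m ])) X →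
  ∑[ ω ∈ words L (suc m) ] 𝟙 (admissible m k X Y ω) ≡ pick (length X) (length Y) k * 𝔟 (suc L) k
∑-admissible L m k []      Y _ Y∷ʳm-incr _ = ∑-admissible-[] L m k Y Y∷ʳm-incr
∑-admissible L m k (t ∷ X) Y (X<t ∷ X-decr) Y∷ʳm-incr (t<Y∷ʳm ∷ X<Y∷ʳm) = begin
  ∑[ ω ∈ words L (suc m) ] 𝟙 (admissible m k (t ∷ X) Y ω)
    ≡⟨ ∑-cong (words L (suc m)) absent-or-mandatory ⟩
  ∑[ ω ∈ words L (suc m) ] (𝟙 (admissible m k X Y ω) + 𝟙 (admissible m k X (t ∷ Y) ω))
    ≡⟨ ∑-+ (words L (suc m)) _ _ ⟩
  (∑[ ω ∈ words L (suc m) ] 𝟙 (admissible m k X Y ω)) + (∑[ ω ∈ words L (suc m) ] 𝟙 (admissible m k X (t ∷ Y) ω))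
    ≡⟨ cong₂ _+_ (∑-admissible L m k X Y X-decr Y∷ʳm-incr X<Y∷ʳm)
                 (∑-admissible L m k X (t ∷ Y) X-decr (t<Y∷ʳm ∷ Y∷ʳm-incr) (All.zipWith (λ (x<t , x<Y) → x<t ∷ x<Y) (X<t , X<Y∷ʳm))) ⟩
  pick (length X) (length Y) k * 𝔟 (suc L) k + pick (length X) (suc (length Y)) k * 𝔟 (suc L) k
    ≡⟨ *-distribʳ-+ (𝔟 (suc L) k) (pick (length X) (length Y) k) _ ⟨
  (pick (length X) (length Y) k + pick (length X) (suc (length Y)) k) * 𝔟 (suc L) k
    ≡⟨ cong (_* 𝔟 (suc L) k) (pick-pascal (length X) (length Y) k) ⟨
  pick (suc (length X)) (length Y) k * 𝔟 (suc L) k ∎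
  where
  open ≡-Reasoning
  t-not-allowed : allowed X Y m t ≡ false
  t-not-allowed rewrite ≢⇒≡ᵇ-false t m (<⇒≢ (proj₂ (All.∷ʳ⁻ t<Y∷ʳm))) | All->⇒elemᵇ-false X<t
                      | All-<⇒elemᵇ-false (All.++⁻ˡ Y t<Y∷ʳm) = refl
  absent-or-mandatory : ∀ ω → 𝟙 (admissible m k (t ∷ X) Y ω) ≡ 𝟙 (admissible m k X Y ω) + 𝟙 (admissible m k X (t ∷ Y) ω)
  absent-or-mandatory ω with elemᵇ t ω in t∈ω
  ... | false rewrite all-allowed-∉ t X Y m ω t∈ω
                    | ∧-zeroʳ (all (allowed X (t ∷ Y) m) ω) | ∧-zeroʳ (patternFree (m ∷ ω)) = sym (+-identityʳ _)
  ... | true  rewrite all-cong ω (allowed-move t X Y m) | elemᵇ⇒all-false (allowed X Y m) t ω t∈ω t-not-allowed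
                    | ∧-zeroʳ (patternFree (m ∷ ω)) = refl

missing : List ℕ → ℕ → List ℕ
missing τ m = filterᵇ (λ v → not (elemᵇ v τ)) (downFrom m)

missing-decreasing : ∀ τ m → AllPairs _>_ (missing τ m)
missing-decreasing τ m = AllPairs.filter⁺ (T? ∘ (λ v → not (elemᵇ v τ))) (AllPairs.applyDownFrom⁺₁ id m (λ j<i _ → j<i))

missing-below : ∀ τ m → All (_< m) (missing τ m)
missing-below τ m = All.filter⁺ (T? ∘ (λ v → not (elemᵇ v τ))) (All.applyDownFrom⁺₁ id m id)

length-missing : ∀ τ m → all (_<ᵇ m) τ ≡ true → length (missing τ m) ≡ m ∸ #distinct τ
length-missing τ m τ<m = begin
  length (missing τ m)                                ≡⟨ length-filterᵇ≡∑ _ (downFrom m) ⟩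
  ∑[ v ∈ downFrom m ] 𝟙 (not (elemᵇ v τ))            ≡⟨ ∑-downFrom m _ ⟩
  ∑[ v ∈ upTo m ] 𝟙 (not (elemᵇ v τ))                ≡⟨ m+n∸n≡m _ (#distinct τ) ⟨
  (∑[ v ∈ upTo m ] 𝟙 (not (elemᵇ v τ))) + #distinct τ ∸ #distinct τ
    ≡⟨ cong (λ n → (∑[ v ∈ upTo m ] 𝟙 (not (elemᵇ v τ))) + n ∸ #distinct τ) (#distinct≡∑ m τ τ<m) ⟩
  (∑[ v ∈ upTo m ] 𝟙 (not (elemᵇ v τ))) + (∑[ v ∈ upTo m ] 𝟙 (elemᵇ v τ)) ∸ #distinct τ
    ≡⟨ cong (_∸ #distinct τ) complement ⟩
  m ∸ #distinct τ ∎
  where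
  open ≡-Reasoning
  complement : (∑[ v ∈ upTo m ] 𝟙 (not (elemᵇ v τ))) + (∑[ v ∈ upTo m ] 𝟙 (elemᵇ v τ)) ≡ m
  complement = trans (sym (∑-+ (upTo m) _ _))
                     (trans (∑-cong (upTo m) (λ v → 𝟙-not+𝟙 (elemᵇ v τ)))
                            (trans (sym (length≡∑1 (upTo m))) (length-upTo m)))

-- The letters available to ω are m and the m ∸ #distinct τ letters below m missing from τ.
∑-words-avoiding : ∀ L m k τ → all (_<ᵇ m) τ ≡ true →
  ∑[ ω ∈ words L (suc m) ] 𝟙 (patternFree (m ∷ ω) ∧ all (λ v → not (elemᵇ v τ)) ω ∧ (#distinct (m ∷ ω) ≡ᵇ k))
    ≡ pick (m ∸ #distinct τ) 0 k * 𝔟 (suc L) k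
∑-words-avoiding L m k τ τ<m = begin
  ∑[ ω ∈ words L (suc m) ] 𝟙 (patternFree (m ∷ ω) ∧ all (λ v → not (elemᵇ v τ)) ω ∧ (#distinct (m ∷ ω) ≡ᵇ k))
    ≡⟨ ∑-words-cong L (suc m) (λ ω ω≤m → cong (λ b → 𝟙 (patternFree (m ∷ ω) ∧ b ∧ (#distinct (m ∷ ω) ≡ᵇ k)))
                                                 (all-cong-bounded _ _ (suc m) ω ω≤m candidates)) ⟩
  ∑[ ω ∈ words L (suc m) ] 𝟙 (admissible m k (missing τ m) [] ω)
    ≡⟨ ∑-admissible L m k (missing τ m) [] (missing-decreasing τ m) ([] ∷ []) (All.map (_∷ []) (missing-below τ m)) ⟩
  pick (length (missing τ m)) 0 k * 𝔟 (suc L) k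
    ≡⟨ cong (λ x → pick x 0 k * 𝔟 (suc L) k) (length-missing τ m τ<m) ⟩
  pick (m ∸ #distinct τ) 0 k * 𝔟 (suc L) k ∎
  where
  open ≡-Reasoning
  candidates : ∀ v → v < suc m → not (elemᵇ v τ) ≡ allowed (missing τ m) [] m v
  candidates v v≤m rewrite elemᵇ-filterᵇ (λ v → not (elemᵇ v τ)) v (downFrom m) | elemᵇ-downFrom v m with m<1+n⇒m<n∨m≡n v≤m
  ... | inj₁ v<m  rewrite ≢⇒≡ᵇ-false v m (<⇒≢ v<m) | <⇒<ᵇ-true v<m = sym (∨-identityʳ _)
  ... | inj₂ refl rewrite ≡ᵇ-refl v | all-<ᵇ⇒elemᵇ-false v τ τ<m = refl

-- Inversion sequences

-- The tails of length b of inversion sequences whose first a entries are given: ω_i ≤ a + i from i = 0.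
invTails : ℕ → ℕ → List (List ℕ)
invTails a zero    = [ [] ]
invTails a (suc b) = concatMap (λ v → map (v ∷_) (invTails (suc a) b)) (upTo (suc a))

∑-invTails-suc : ∀ a b (f : List ℕ → ℕ) →
  ∑ (invTails a (suc b)) f ≡ ∑[ v ∈ upTo (suc a) ] ∑[ w ∈ invTails (suc a) b ] f (v ∷ w)
∑-invTails-suc a b f =
  trans (∑-concatMap (upTo (suc a)) (λ v → map (v ∷_) (invTails (suc a) b)) f) (∑-cong (upTo (suc a)) (λ v → ∑-map (invTails (suc a) b) (v ∷_) f))

∑-invSeqs-suc : ∀ a (f : List ℕ → ℕ) → ∑ (invSeqs (suc a)) f ≡ ∑[ τ ∈ invSeqs a ] ∑[ v ∈ upTo (suc a) ] f (τ ++ [ v ])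
∑-invSeqs-suc a f =
  trans (∑-concatMap (invSeqs a) (λ τ → map (λ v → τ ++ [ v ]) (upTo (suc a))) f) (∑-cong (invSeqs a) (λ τ → ∑-map (upTo (suc a)) (λ v → τ ++ [ v ]) f))

∑-invSeqs-+ : ∀ a b (f : List ℕ → ℕ) → ∑ (invSeqs (a + b)) f ≡ ∑[ τ ∈ invSeqs a ] ∑[ ω ∈ invTails a b ] f (τ ++ ω)
∑-invSeqs-+ a zero    f rewrite +-identityʳ a =
  ∑-cong (invSeqs a) (λ τ → trans (cong f (sym (++-identityʳ τ))) (sym (+-identityʳ _)))
∑-invSeqs-+ a (suc b) f rewrite +-suc a b = begin
  ∑ (invSeqs (suc a + b)) f
    ≡⟨ ∑-invSeqs-+ (suc a) b f ⟩
  ∑[ τ ∈ invSeqs (suc a) ] ∑[ ω ∈ invTails (suc a) b ] f (τ ++ ω)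
    ≡⟨ ∑-invSeqs-suc a _ ⟩
  ∑[ τ ∈ invSeqs a ] ∑[ v ∈ upTo (suc a) ] ∑[ ω ∈ invTails (suc a) b ] f ((τ ++ [ v ]) ++ ω)
    ≡⟨ ∑-cong (invSeqs a) (λ τ → ∑-cong (upTo (suc a)) (λ v → ∑-cong (invTails (suc a) b) (λ ω → cong f (++-assoc τ [ v ] ω)))) ⟩
  ∑[ τ ∈ invSeqs a ] ∑[ v ∈ upTo (suc a) ] ∑[ ω ∈ invTails (suc a) b ] f (τ ++ v ∷ ω)
    ≡⟨ ∑-cong (invSeqs a) (λ τ → ∑-invTails-suc a b (λ ω → f (τ ++ ω))) ⟨
  ∑[ τ ∈ invSeqs a ] ∑[ ω ∈ invTails a (suc b) ] f (τ ++ ω) ∎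
  where open ≡-Reasoning

-- As m < c, the bound ω_i ≤ c + i on a tail is implied by ω_i ≤ m.
∑-invTails-bounded : ∀ L c m (R : List ℕ → Bool) → m < c →
  ∑[ ω ∈ invTails c L ] 𝟙 (all (_<ᵇ suc m) ω ∧ R ω) ≡ ∑[ ω ∈ words L (suc m) ] 𝟙 (R ω)
∑-invTails-bounded zero    c m R m<c = refl
∑-invTails-bounded (suc L) c m R m<c = begin
  ∑[ ω ∈ invTails c (suc L) ] 𝟙 (all (_<ᵇ suc m) ω ∧ R ω)
    ≡⟨ ∑-invTails-suc c L _ ⟩
  ∑[ v ∈ upTo (suc c) ] ∑[ w ∈ invTails (suc c) L ] 𝟙 (((v <ᵇ suc m) ∧ all (_<ᵇ suc m) w) ∧ R (v ∷ w))
    ≡⟨ ∑-cong (upTo (suc c)) (λ v → trans (∑-cong (invTails (suc c) L) (λ w → trans (cong 𝟙 (∧-assoc (v <ᵇ suc m) _ _)) (𝟙-∧ (v <ᵇ suc m) _)))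
                                          (∑-*ˡ (invTails (suc c) L) (𝟙 (v <ᵇ suc m)) _)) ⟩
  ∑[ v ∈ upTo (suc c) ] 𝟙 (v <ᵇ suc m) * (∑[ w ∈ invTails (suc c) L ] 𝟙 (all (_<ᵇ suc m) w ∧ R (v ∷ w)))
    ≡⟨ ∑-cong (upTo (suc c)) (λ v → cong (𝟙 (v <ᵇ suc m) *_) (∑-invTails-bounded L (suc c) m (λ w → R (v ∷ w)) (m<n⇒m<1+n m<c))) ⟩
  ∑[ v ∈ upTo (suc c) ] 𝟙 (v <ᵇ suc m) * (∑[ w ∈ words L (suc m) ] 𝟙 (R (v ∷ w)))
    ≡⟨ ∑-upTo-restrict (suc c) (suc m) _ (m<n⇒m<1+n m<c) ⟩
  ∑[ v ∈ upTo (suc m) ] ∑[ w ∈ words L (suc m) ] 𝟙 (R (v ∷ w))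
    ≡⟨ ∑-words-suc L (suc m) _ ⟨
  ∑[ ω ∈ words (suc L) (suc m) ] 𝟙 (R ω) ∎
  where open ≡-Reasoning

countedAt : ℕ → ℕ → List ℕ → ℕ
countedAt m d σ = 𝟙 (avoids000-010 σ ∧ eqℤ (maxSeq σ) (pos m) ∧ (distinct σ ≡ᵇ d))

counted-split : ∀ m d τ ω → all (_<ᵇ m) τ ≡ true →
  countedAt m d (τ ++ m ∷ ω)
    ≡ 𝟙 (patternFree τ) * 𝟙 (all (_<ᵇ suc m) ω ∧ patternFree (m ∷ ω) ∧ all (λ v → not (elemᵇ v τ)) ω
                                ∧ (#distinct (m ∷ ω) ≡ᵇ d ∸ #distinct τ))
counted-split m d τ ω τ<m
  rewrite avoids000-010≡patternFree (τ ++ m ∷ ω) | patternFree-++-∷ m τ ω τ<m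
        | eqℤ-maxSeq (τ ++ m ∷ ω) m | elemᵇ-++ m τ (m ∷ ω) | all-<ᵇ⇒elemᵇ-false m τ τ<m | ≡ᵇ-refl m
        | all-++ (_<ᵇ suc m) τ (m ∷ ω) | all-<ᵇ-suc m τ (all-<ᵇ⇒elemᵇ-false m τ τ<m) | τ<m | <⇒<ᵇ-true (n<1+n m)
        | distinct≡#distinct (τ ++ m ∷ ω)
  = reorder (patternFree τ) (patternFree (m ∷ ω)) _ (all (_<ᵇ suc m) ω) (disjoint-sym τ ω) distinct-shift
  where
  distinct-shift : all (λ t → not (elemᵇ t ω)) τ ≡ true →
    (#distinct (τ ++ m ∷ ω) ≡ᵇ d) ≡ (#distinct (m ∷ ω) ≡ᵇ d ∸ #distinct τ)
  distinct-shift disjoint = begin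
    #distinct (τ ++ m ∷ ω) ≡ᵇ d                ≡⟨ cong (_≡ᵇ d) (#distinct-++ τ (m ∷ ω) disjoint′) ⟩
    #distinct τ + #distinct (m ∷ ω) ≡ᵇ d       ≡⟨ +-≡ᵇ-∸ (#distinct τ) (#distinct (m ∷ ω)) d (#distinct-∷-positive m ω) ⟩
    #distinct (m ∷ ω) ≡ᵇ d ∸ #distinct τ       ∎
    where
    open ≡-Reasoning
    disjoint′ : all (λ t → not (elemᵇ t (m ∷ ω))) τ ≡ true
    disjoint′ = trans (all-cong-bounded _ _ m τ τ<m (λ v v<m → cong (λ b → not (b ∨ elemᵇ v ω)) (≢⇒≡ᵇ-false v m (<⇒≢ v<m)))) disjoint
  reorder : ∀ a b c e {c′ x y} → c ≡ c′ → (c ≡ true → x ≡ y) → 𝟙 ((a ∧ b ∧ c) ∧ e ∧ x) ≡ 𝟙 a * 𝟙 (e ∧ b ∧ c′ ∧ y)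
  reorder false b     c     e     refl _   = refl
  reorder true  true  true  true  refl x≡y rewrite x≡y refl = sym (+-identityʳ _)
  reorder true  true  true  false refl _   = refl
  reorder true  true  false e     refl _   rewrite ∧-zeroʳ e = refl
  reorder true  false c     e     refl _   rewrite ∧-zeroʳ e = refl

𝟙-below-max : ∀ m i x xs → 𝟙 ((patternFree (x ∷ xs) ∧ all (_<ᵇ m) (x ∷ xs)) ∧ (#distinct (x ∷ xs) ≡ᵇ i))
                         ≡ ∑[ j ∈ upTo m ] countedAt j i (x ∷ xs)
𝟙-below-max m i x xs = begin
  𝟙 ((P ∧ all (_<ᵇ m) σ) ∧ D)                      ≡⟨ cong 𝟙 (∧-assoc P _ D) ⟩
  𝟙 (P ∧ all (_<ᵇ m) σ ∧ D)                        ≡⟨ 𝟙-∧-middle P _ D ⟩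
  𝟙 (P ∧ D) * 𝟙 (all (_<ᵇ m) σ)                    ≡⟨ cong (λ b → 𝟙 (P ∧ D) * 𝟙 b) (all-<ᵇ-∷ x xs m) ⟩
  𝟙 (P ∧ D) * 𝟙 (maxEntry σ <ᵇ m)                  ≡⟨ cong (𝟙 (P ∧ D) *_) (∑-upTo-𝟙≡ᵇ (maxEntry σ) m) ⟨
  𝟙 (P ∧ D) * (∑[ j ∈ upTo m ] 𝟙 (maxEntry σ ≡ᵇ j)) ≡⟨ ∑-*ˡ (upTo m) (𝟙 (P ∧ D)) _ ⟨
  ∑[ j ∈ upTo m ] 𝟙 (P ∧ D) * 𝟙 (maxEntry σ ≡ᵇ j)  ≡⟨ ∑-cong (upTo m) (λ j → sym (𝟙-∧-middle P (maxEntry σ ≡ᵇ j) D)) ⟩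
  ∑[ j ∈ upTo m ] 𝟙 (P ∧ (maxEntry σ ≡ᵇ j) ∧ D)    ≡⟨ ∑-cong (upTo m) (λ j → cong 𝟙 (cong₂ _∧_ (sym (avoids000-010≡patternFree σ))
                                                        (cong₂ _∧_ (cong (λ z → eqℤ z (pos j)) (sym (maxSeq-∷ x xs)))
                                                                   (cong (_≡ᵇ i) (sym (distinct≡#distinct σ)))))) ⟩
  ∑[ j ∈ upTo m ] countedAt j i σ                   ∎
  where
  open ≡-Reasoning
  σ = x ∷ xs
  P = patternFree σ
  D = #distinct σ ≡ᵇ i

-- Sorting the sequences counted by 𝔞 by the position of their first m: m∉prefix a b counts those of
-- length a + b with no m among the first a entries, firstMaxAt a b those of length a + 1 + b whose first
-- m is entry a + 1.
module FirstMaximum (m d : ℕ) where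

  counted : List ℕ → ℕ
  counted = countedAt m d

  m∉prefix : ℕ → ℕ → ℕ
  m∉prefix a b = ∑[ τ ∈ invSeqs a ] 𝟙 (not (elemᵇ m τ)) * (∑[ ω ∈ invTails a b ] counted (τ ++ ω))

  firstMaxAt : ℕ → ℕ → ℕ
  firstMaxAt a b =
    ∑[ τ ∈ invSeqs a ] 𝟙 (not (elemᵇ m τ)) * (∑[ v ∈ upTo (suc a) ] 𝟙 (v ≡ᵇ m) * (∑[ ω ∈ invTails (suc a) b ] counted (τ ++ v ∷ ω)))

  m∉prefix-suc : ∀ a b → m∉prefix a (suc b) ≡ firstMaxAt a b + m∉prefix (suc a) b
  m∉prefix-suc a b = begin
    m∉prefix a (suc b)
      ≡⟨ ∑-cong (invSeqs a) (λ τ → cong (𝟙 (not (elemᵇ m τ)) *_) (trans (∑-invTails-suc a b _) (split τ))) ⟩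
    ∑[ τ ∈ invSeqs a ] 𝟙 (not (elemᵇ m τ)) * ((∑[ v ∈ U ] 𝟙 (v ≡ᵇ m) * G τ v) + (∑[ v ∈ U ] 𝟙 (not (v ≡ᵇ m)) * G τ v))
      ≡⟨ ∑-cong (invSeqs a) (λ τ → *-distribˡ-+ (𝟙 (not (elemᵇ m τ))) _ _) ⟩
    ∑[ τ ∈ invSeqs a ] (𝟙 (not (elemᵇ m τ)) * (∑[ v ∈ U ] 𝟙 (v ≡ᵇ m) * G τ v) + 𝟙 (not (elemᵇ m τ)) * (∑[ v ∈ U ] 𝟙 (not (v ≡ᵇ m)) * G τ v))
      ≡⟨ ∑-+ (invSeqs a) _ _ ⟩
    firstMaxAt a b + (∑[ τ ∈ invSeqs a ] 𝟙 (not (elemᵇ m τ)) * (∑[ v ∈ U ] 𝟙 (not (v ≡ᵇ m)) * G τ v))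
      ≡⟨ cong (firstMaxAt a b +_) (∑-cong (invSeqs a) extend) ⟩
    firstMaxAt a b + (∑[ τ ∈ invSeqs a ] ∑[ v ∈ U ] 𝟙 (not (elemᵇ m (τ ++ [ v ]))) * (∑[ ω ∈ invTails (suc a) b ] counted ((τ ++ [ v ]) ++ ω)))
      ≡⟨ cong (firstMaxAt a b +_) (∑-invSeqs-suc a _) ⟨
    firstMaxAt a b + m∉prefix (suc a) b ∎
    where
    open ≡-Reasoning
    U = upTo (suc a)
    G : List ℕ → ℕ → ℕ
    G τ v = ∑[ ω ∈ invTails (suc a) b ] counted (τ ++ v ∷ ω)
    split : ∀ τ → ∑[ v ∈ U ] G τ v ≡ (∑[ v ∈ U ] 𝟙 (v ≡ᵇ m) * G τ v) + (∑[ v ∈ U ] 𝟙 (not (v ≡ᵇ m)) * G τ v)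
    split τ = trans (∑-cong U (λ v → 𝟙-split (v ≡ᵇ m) (G τ v))) (∑-+ U (λ v → 𝟙 (v ≡ᵇ m) * G τ v) (λ v → 𝟙 (not (v ≡ᵇ m)) * G τ v))
    extend : ∀ τ → 𝟙 (not (elemᵇ m τ)) * (∑[ v ∈ U ] 𝟙 (not (v ≡ᵇ m)) * G τ v)
                 ≡ ∑[ v ∈ U ] 𝟙 (not (elemᵇ m (τ ++ [ v ]))) * (∑[ ω ∈ invTails (suc a) b ] counted ((τ ++ [ v ]) ++ ω))
    extend τ = trans (sym (∑-*ˡ U (𝟙 (not (elemᵇ m τ))) (λ v → 𝟙 (not (v ≡ᵇ m)) * G τ v))) (∑-cong U λ v → begin
      𝟙 (not (elemᵇ m τ)) * (𝟙 (not (v ≡ᵇ m)) * G τ v)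
        ≡⟨ *-assoc (𝟙 (not (elemᵇ m τ))) _ _ ⟨
      𝟙 (not (elemᵇ m τ)) * 𝟙 (not (v ≡ᵇ m)) * G τ v
        ≡⟨ cong₂ _*_ (trans (cong (λ b → 𝟙 (not (elemᵇ m τ)) * 𝟙 (not b)) (≡ᵇ-sym v m)) (sym (𝟙-not-∨ (elemᵇ m τ) (m ≡ᵇ v))))
                     (∑-cong (invTails (suc a) b) (λ ω → cong counted (sym (++-assoc τ [ v ] ω)))) ⟩
      𝟙 (not (elemᵇ m τ ∨ (m ≡ᵇ v))) * (∑[ ω ∈ invTails (suc a) b ] counted ((τ ++ [ v ]) ++ ω))
        ≡⟨ cong (λ z → 𝟙 (not z) * (∑[ ω ∈ invTails (suc a) b ] counted ((τ ++ [ v ]) ++ ω)))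
                (trans (cong (elemᵇ m τ ∨_) (sym (∨-identityʳ (m ≡ᵇ v)))) (sym (elemᵇ-++ m τ [ v ]))) ⟩
      𝟙 (not (elemᵇ m (τ ++ [ v ]))) * (∑[ ω ∈ invTails (suc a) b ] counted ((τ ++ [ v ]) ++ ω)) ∎)

  m∉prefix-iterate : ∀ a b → m∉prefix a b ≡ (∑[ t ∈ upTo b ] firstMaxAt (a + t) (b ∸ suc t)) + m∉prefix (a + b) 0
  m∉prefix-iterate a zero    rewrite +-identityʳ a = refl
  m∉prefix-iterate a (suc b) = begin
    m∉prefix a (suc b)
      ≡⟨ m∉prefix-suc a b ⟩
    firstMaxAt a b + m∉prefix (suc a) b
      ≡⟨ cong (firstMaxAt a b +_) (m∉prefix-iterate (suc a) b) ⟩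
    firstMaxAt a b + ((∑[ t ∈ upTo b ] firstMaxAt (suc a + t) (b ∸ suc t)) + m∉prefix (suc a + b) 0)
      ≡⟨ +-assoc (firstMaxAt a b) _ _ ⟨
    firstMaxAt a b + (∑[ t ∈ upTo b ] firstMaxAt (suc a + t) (b ∸ suc t)) + m∉prefix (suc a + b) 0
      ≡⟨ cong₂ _+_ shift (cong (λ z → m∉prefix z 0) (sym (+-suc a b))) ⟩
    (∑[ t ∈ upTo (suc b) ] firstMaxAt (a + t) (suc b ∸ suc t)) + m∉prefix (a + suc b) 0 ∎
    where
    open ≡-Reasoning
    shift : firstMaxAt a b + (∑[ t ∈ upTo b ] firstMaxAt (suc a + t) (b ∸ suc t))
          ≡ ∑[ t ∈ upTo (suc b) ] firstMaxAt (a + t) (suc b ∸ suc t)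
    shift = sym (trans (∑-upTo-suc′ b _) (cong₂ _+_ (cong (λ z → firstMaxAt z b) (+-identityʳ a))
                                                  (∑-cong (upTo b) (λ t → cong (λ z → firstMaxAt z (b ∸ suc t)) (+-suc a t)))))

  m∉prefix-zero : ∀ n → m∉prefix n 0 ≡ 0
  m∉prefix-zero n = ∑-≡0 (invSeqs n) m∉σ
    where
    m∉σ : ∀ τ → 𝟙 (not (elemᵇ m τ)) * (counted (τ ++ []) + 0) ≡ 0
    m∉σ τ rewrite ++-identityʳ τ | eqℤ-maxSeq τ m with elemᵇ m τ
    ... | true  = refl
    ... | false rewrite ∧-zeroʳ (avoids000-010 τ) = refl

  𝔞≡∑firstMaxAt : ∀ n → 𝔞 n m d ≡ ∑[ t ∈ upTo n ] firstMaxAt t (n ∸ suc t)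
  𝔞≡∑firstMaxAt n = begin
    𝔞 n m d                                                       ≡⟨ length-filterᵇ≡∑ _ (invSeqs n) ⟩
    ∑ (invSeqs n) counted                                         ≡⟨ ∑-invSeqs-+ 0 n counted ⟩
    ∑[ τ ∈ invSeqs 0 ] ∑[ ω ∈ invTails 0 n ] counted (τ ++ ω)     ≡⟨ cong (_+ 0) (sym (+-identityʳ _)) ⟩
    m∉prefix 0 n                                                  ≡⟨ m∉prefix-iterate 0 n ⟩
    (∑[ t ∈ upTo n ] firstMaxAt t (n ∸ suc t)) + m∉prefix n 0     ≡⟨ cong ((∑[ t ∈ upTo n ] firstMaxAt t (n ∸ suc t)) +_) (m∉prefix-zero n) ⟩
    (∑[ t ∈ upTo n ] firstMaxAt t (n ∸ suc t)) + 0                ≡⟨ +-identityʳ _ ⟩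
    ∑[ t ∈ upTo n ] firstMaxAt t (n ∸ suc t)                      ∎
    where open ≡-Reasoning

  -- The entry at position a + 1 ≤ m of an inversion sequence is below m.
  firstMaxAt-below : ∀ a b → a < m → firstMaxAt a b ≡ 0
  firstMaxAt-below a b a<m = ∑-≡0 (invSeqs a) no-m
    where
    no-m : ∀ τ → 𝟙 (not (elemᵇ m τ)) * (∑[ v ∈ upTo (suc a) ] 𝟙 (v ≡ᵇ m) * (∑[ ω ∈ invTails (suc a) b ] counted (τ ++ v ∷ ω))) ≡ 0
    no-m τ = trans (cong (𝟙 (not (elemᵇ m τ)) *_) (∑-upTo-zero (suc a) v≢m)) (*-zeroʳ (𝟙 (not (elemᵇ m τ))))
      where
      v≢m : ∀ v → v < suc a → 𝟙 (v ≡ᵇ m) * (∑[ ω ∈ invTails (suc a) b ] counted (τ ++ v ∷ ω)) ≡ 0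
      v≢m v v≤a rewrite ≢⇒≡ᵇ-false v m (<⇒≢ (≤-<-trans (m<1+n⇒m≤n v≤a) a<m)) = refl

  firstMaxAt-above : ∀ a b → m ≤ a →
    firstMaxAt a b ≡ ∑[ τ ∈ invSeqs a ] 𝟙 (not (elemᵇ m τ)) * (∑[ ω ∈ invTails (suc a) b ] counted (τ ++ m ∷ ω))
  firstMaxAt-above a b m≤a =
    ∑-cong (invSeqs a) (λ τ → cong (𝟙 (not (elemᵇ m τ)) *_) (∑-upTo-δ (suc a) m (λ v → ∑[ ω ∈ invTails (suc a) b ] counted (τ ++ v ∷ ω)) (s≤s m≤a)))

  tailCount : ℕ → ℕ → ℕ
  tailCount b i = pick (m ∸ i) 0 (d ∸ i) * 𝔟 (suc b) (d ∸ i)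

  prefix-weight : ∀ a b τ → m ≤ a →
    𝟙 (not (elemᵇ m τ)) * (∑[ ω ∈ invTails (suc a) b ] counted (τ ++ m ∷ ω))
      ≡ 𝟙 (patternFree τ ∧ all (_<ᵇ m) τ) * tailCount b (#distinct τ)
  prefix-weight a b τ m≤a with all (_<ᵇ m) τ in τ<m
  ... | true rewrite all-<ᵇ⇒elemᵇ-false m τ τ<m | ∧-identityʳ (patternFree τ) = begin
    1 * (∑[ ω ∈ invTails (suc a) b ] counted (τ ++ m ∷ ω))
      ≡⟨ *-identityˡ _ ⟩
    ∑[ ω ∈ invTails (suc a) b ] counted (τ ++ m ∷ ω)
      ≡⟨ ∑-cong (invTails (suc a) b) (λ ω → counted-split m d τ ω τ<m) ⟩
    ∑[ ω ∈ invTails (suc a) b ] 𝟙 (patternFree τ) * 𝟙 (all (_<ᵇ suc m) ω ∧ Q ω)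
      ≡⟨ ∑-*ˡ (invTails (suc a) b) (𝟙 (patternFree τ)) _ ⟩
    𝟙 (patternFree τ) * (∑[ ω ∈ invTails (suc a) b ] 𝟙 (all (_<ᵇ suc m) ω ∧ Q ω))
      ≡⟨ cong (𝟙 (patternFree τ) *_) (∑-invTails-bounded b (suc a) m Q (s≤s m≤a)) ⟩
    𝟙 (patternFree τ) * (∑[ ω ∈ words b (suc m) ] 𝟙 (Q ω))
      ≡⟨ cong (𝟙 (patternFree τ) *_) (∑-words-avoiding b m (d ∸ #distinct τ) τ τ<m) ⟩
    𝟙 (patternFree τ) * tailCount b (#distinct τ) ∎
    where
    open ≡-Reasoning
    Q : List ℕ → Bool
    Q ω = patternFree (m ∷ ω) ∧ all (λ v → not (elemᵇ v τ)) ω ∧ (#distinct (m ∷ ω) ≡ᵇ d ∸ #distinct τ)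
  ... | false rewrite ∧-zeroʳ (patternFree τ) with elemᵇ m τ in m∈τ
  ...   | true  = refl
  ...   | false = trans (*-identityˡ _) (∑-≡0 (invTails (suc a) b) not-max)
    where
    not-max : ∀ ω → counted (τ ++ m ∷ ω) ≡ 0
    not-max ω rewrite eqℤ-maxSeq (τ ++ m ∷ ω) m | all-++ (_<ᵇ suc m) τ (m ∷ ω) | all-<ᵇ-suc m τ m∈τ | τ<m
                    | ∧-zeroʳ (elemᵇ m (τ ++ m ∷ ω)) | ∧-zeroʳ (avoids000-010 (τ ++ m ∷ ω)) = refl

  ∑-prefixes : ∀ a i → 1 ≤ a →
    ∑[ τ ∈ invSeqs a ] 𝟙 ((patternFree τ ∧ all (_<ᵇ m) τ) ∧ (#distinct τ ≡ᵇ i)) ≡ ∑[ j ∈ upTo m ] 𝔞 a j i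
  ∑-prefixes (suc t) i _ = begin
    ∑[ τ ∈ invSeqs (suc t) ] 𝟙 ((patternFree τ ∧ all (_<ᵇ m) τ) ∧ (#distinct τ ≡ᵇ i))
      ≡⟨ ∑-invSeqs-suc t _ ⟩
    ∑[ τ ∈ invSeqs t ] ∑[ v ∈ upTo (suc t) ] 𝟙 ((patternFree (τ ++ [ v ]) ∧ all (_<ᵇ m) (τ ++ [ v ])) ∧ (#distinct (τ ++ [ v ]) ≡ᵇ i))
      ≡⟨ ∑-cong (invSeqs t) (λ τ → ∑-cong (upTo (suc t)) (λ v → nonempty τ v)) ⟩
    ∑[ τ ∈ invSeqs t ] ∑[ v ∈ upTo (suc t) ] ∑[ j ∈ upTo m ] countedAt j i (τ ++ [ v ])
      ≡⟨ ∑-invSeqs-suc t (λ σ → ∑[ j ∈ upTo m ] countedAt j i σ) ⟨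
    ∑[ σ ∈ invSeqs (suc t) ] ∑[ j ∈ upTo m ] countedAt j i σ
      ≡⟨ ∑-comm (invSeqs (suc t)) (upTo m) (λ σ j → countedAt j i σ) ⟩
    ∑[ j ∈ upTo m ] ∑[ σ ∈ invSeqs (suc t) ] countedAt j i σ
      ≡⟨ ∑-cong (upTo m) (λ j → sym (length-filterᵇ≡∑ _ (invSeqs (suc t)))) ⟩
    ∑[ j ∈ upTo m ] 𝔞 (suc t) j i ∎
    where
    open ≡-Reasoning
    nonempty : ∀ τ v → 𝟙 ((patternFree (τ ++ [ v ]) ∧ all (_<ᵇ m) (τ ++ [ v ])) ∧ (#distinct (τ ++ [ v ]) ≡ᵇ i))
                     ≡ ∑[ j ∈ upTo m ] countedAt j i (τ ++ [ v ])
    nonempty []      v = 𝟙-below-max m i v []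
    nonempty (y ∷ τ) v = 𝟙-below-max m i y (τ ++ [ v ])

  firstMaxAt≡ : ∀ a b → 1 ≤ m → m ≤ a →
    firstMaxAt a b ≡ ∑[ i ∈ upTo d ] tailCount b i * (∑[ j ∈ upTo m ] 𝔞 a j i)
  firstMaxAt≡ a b 1≤m m≤a = begin
    firstMaxAt a b
      ≡⟨ firstMaxAt-above a b m≤a ⟩
    ∑[ τ ∈ invSeqs a ] 𝟙 (not (elemᵇ m τ)) * (∑[ ω ∈ invTails (suc a) b ] counted (τ ++ m ∷ ω))
      ≡⟨ ∑-cong (invSeqs a) (λ τ → prefix-weight a b τ m≤a) ⟩
    ∑[ τ ∈ invSeqs a ] 𝟙 (patternFree τ ∧ all (_<ᵇ m) τ) * tailCount b (#distinct τ)
      ≡⟨ ∑-by-value (invSeqs a) (λ τ → patternFree τ ∧ all (_<ᵇ m) τ) #distinct (tailCount b) d vanishes ⟩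
    ∑[ i ∈ upTo d ] tailCount b i * (∑[ τ ∈ invSeqs a ] 𝟙 ((patternFree τ ∧ all (_<ᵇ m) τ) ∧ (#distinct τ ≡ᵇ i)))
      ≡⟨ ∑-cong (upTo d) (λ i → cong (tailCount b i *_) (∑-prefixes a i (≤-trans 1≤m m≤a))) ⟩
    ∑[ i ∈ upTo d ] tailCount b i * (∑[ j ∈ upTo m ] 𝔞 a j i) ∎
    where
    open ≡-Reasoning
    vanishes : ∀ i → d ≤ i → tailCount b i ≡ 0
    vanishes i d≤i rewrite m≤n⇒m∸n≡0 d≤i = refl

  𝔞≡∑firstMaxAt-from-m : ∀ n → m ≤ n → 𝔞 n m d ≡ ∑[ t ∈ upTo (n ∸ m) ] firstMaxAt (m + t) (n ∸ suc (m + t))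
  𝔞≡∑firstMaxAt-from-m n m≤n = begin
    𝔞 n m d
      ≡⟨ 𝔞≡∑firstMaxAt n ⟩
    ∑[ t ∈ upTo n ] F t
      ≡⟨ cong (λ z → ∑ (upTo z) F) (m+[n∸m]≡n m≤n) ⟨
    ∑ (upTo (m + (n ∸ m))) F
      ≡⟨ ∑-upTo-+ m (n ∸ m) F ⟩
    ∑ (upTo m) F + (∑[ t ∈ upTo (n ∸ m) ] F (m + t))
      ≡⟨ cong (_+ (∑[ t ∈ upTo (n ∸ m) ] F (m + t))) (∑-upTo-zero m (λ t t<m → firstMaxAt-below t (n ∸ suc t) t<m)) ⟩
    ∑[ t ∈ upTo (n ∸ m) ] F (m + t) ∎
    where
    open ≡-Reasoning
    F : ℕ → ℕ
    F t = firstMaxAt t (n ∸ suc t)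

𝔞-first-maximum : ∀ n m d → 1 ≤ m → m ≤ n →
  𝔞 n m d ≡ ∑[ i ∈ upTo d ] ((m ∸ i) C (d ∸ i ∸ 1)) * (∑[ t ∈ upTo (n ∸ m) ] 𝔟 (n ∸ (m + t)) (d ∸ i) * (∑[ j ∈ upTo m ] 𝔞 (m + t) j i))
𝔞-first-maximum n m d 1≤m m≤n = begin
  𝔞 n m d
    ≡⟨ 𝔞≡∑firstMaxAt-from-m n m≤n ⟩
  ∑[ t ∈ upTo (n ∸ m) ] firstMaxAt (m + t) (n ∸ suc (m + t))
    ≡⟨ ∑-cong (upTo (n ∸ m)) (λ t → firstMaxAt≡ (m + t) (n ∸ suc (m + t)) 1≤m (m≤m+n m t)) ⟩
  ∑[ t ∈ upTo (n ∸ m) ] ∑[ i ∈ upTo d ] tailCount (n ∸ suc (m + t)) i * A t i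
    ≡⟨ ∑-comm (upTo (n ∸ m)) (upTo d) (λ t i → tailCount (n ∸ suc (m + t)) i * A t i) ⟩
  ∑[ i ∈ upTo d ] ∑[ t ∈ upTo (n ∸ m) ] tailCount (n ∸ suc (m + t)) i * A t i
    ≡⟨ ∑-upTo-cong d (λ i i<d → trans (∑-upTo-cong (n ∸ m) (λ t t<n∸m → term i t i<d t<n∸m)) (∑-*ˡ (upTo (n ∸ m)) ((m ∸ i) C (d ∸ i ∸ 1)) (λ t → 𝔟 (n ∸ (m + t)) (d ∸ i) * A t i))) ⟩
  ∑[ i ∈ upTo d ] ((m ∸ i) C (d ∸ i ∸ 1)) * (∑[ t ∈ upTo (n ∸ m) ] 𝔟 (n ∸ (m + t)) (d ∸ i) * A t i) ∎
  where
  open ≡-Reasoning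
  open FirstMaximum m d
  A : ℕ → ℕ → ℕ
  A t i = ∑[ j ∈ upTo m ] 𝔞 (m + t) j i
  term : ∀ i t → i < d → t < n ∸ m →
    tailCount (n ∸ suc (m + t)) i * A t i ≡ ((m ∸ i) C (d ∸ i ∸ 1)) * (𝔟 (n ∸ (m + t)) (d ∸ i) * A t i)
  term i t i<d t<n∸m = trans (*-assoc (pick (m ∸ i) 0 (d ∸ i)) _ (A t i))
    (cong₂ _*_ (pick-positive (m ∸ i) (m<n⇒0<n∸m i<d)) (cong (λ z → 𝔟 z (d ∸ i) * A t i) (sym (∸-suc (<∸⇒+< {m} t<n∸m)))))

theorem19 : (n m d : ℕ) → 2 ≤ d → d ≤ m + 1 → m + 1 ≤ n →
    𝔞 n m d ≡
      sumFromTo 0 (d ∸ 1) (λ i →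
        ((m ∸ i) C (d ∸ i ∸ 1)) *
          sumFromTo (m + 1) n (λ p →
            𝔟 (n ∸ p + 1) (d ∸ i) * sumFromTo 0 (m ∸ 1) (λ j → 𝔞 (p ∸ 1) j i)))
theorem19 n m d 2≤d d≤m+1 m+1≤n = begin
  𝔞 n m d
    ≡⟨ 𝔞-first-maximum n m d 1≤m (≤-trans (m≤m+n m 1) m+1≤n) ⟩
  ∑[ i ∈ upTo d ] ((m ∸ i) C (d ∸ i ∸ 1)) * (∑[ t ∈ upTo (n ∸ m) ] 𝔟 (n ∸ (m + t)) (d ∸ i) * (∑[ j ∈ upTo m ] 𝔞 (m + t) j i))
    ≡⟨ ∑-cong (upTo d) (λ i → cong (((m ∸ i) C (d ∸ i ∸ 1)) *_) (sym (inner i))) ⟩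
  ∑[ i ∈ upTo d ] ((m ∸ i) C (d ∸ i ∸ 1)) * Inner i
    ≡⟨ sumFromTo-0 d _ (≤-trans (n≤1+n 1) 2≤d) ⟨
  sumFromTo 0 (d ∸ 1) (λ i → ((m ∸ i) C (d ∸ i ∸ 1)) * Inner i) ∎
  where
  open ≡-Reasoning
  1≤m : 1 ≤ m
  1≤m = +-cancelʳ-≤ 1 1 m (≤-trans 2≤d d≤m+1)
  Inner : ℕ → ℕ
  Inner i = sumFromTo (m + 1) n (λ p → 𝔟 (n ∸ p + 1) (d ∸ i) * sumFromTo 0 (m ∸ 1) (λ j → 𝔞 (p ∸ 1) j i))
  inner : ∀ i → Inner i ≡ ∑[ t ∈ upTo (n ∸ m) ] 𝔟 (n ∸ (m + t)) (d ∸ i) * (∑[ j ∈ upTo m ] 𝔞 (m + t) j i)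
  inner i = trans (sumFromTo-suc m n (λ p → 𝔟 (n ∸ p + 1) (d ∸ i) * sumFromTo 0 (m ∸ 1) (λ j → 𝔞 (p ∸ 1) j i))) (∑-upTo-cong (n ∸ m) λ t t<n∸m →
    cong₂ _*_ (cong (λ z → 𝔟 z (d ∸ i)) (trans (+-comm _ 1) (sym (∸-suc (<∸⇒+< {m} t<n∸m)))))
              (sumFromTo-0 m (λ j → 𝔞 (m + t) j i) 1≤m))
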